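{- There exists an infinite binary word that is $3^+$-free, contains exactly two distinct overlaps and exactly four distinct squares as factors, and contains no square of even period.
   Context: A repetition is a word $u^nv$ with $u$ nonempty and $v$ a prefix of $u$; its period is $|u|$ and its exponent is $|u^nv|/|u|$. A word is $3^+$-free if it contains no repetition of exponent strictly greater than $3$ as a factor. A square is a repetition of exponent $2$ (a word $uu$, of period $|u|$); an overlap is a repetition of exponent strictly greater than $2$. Counts refer to distinct factors. -}

module Defs where

open import Data.Bool using (Bool)
open import Data.Nat using (ℕ; zero; suc; _+_; _*_; _<_)
open import Data.List using (List; []; _∷_; _++_; length; concat; replicate)
open import Data.List.Membership.Propositional using (_∈_)
open import Data.List.Relation.Unary.All using (All)
open import Data.List.Relation.Unary.Unique.Propositional using (Unique)
open import Data.List.Relation.Binary.Prefix.Heterogeneous using (Prefix)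
open import Data.Product using (Σ; ∃; ∃-syntax; _×_)
open import Relation.Binary.PropositionalEquality using (_≡_)
open import Relation.Nullary using (¬_)

Word : Set
Word = List Bool

InfWord : Set
InfWord = ℕ → Bool

slice : InfWord → ℕ → ℕ → Word
slice w i zero    = []
slice w i (suc n) = w i ∷ slice w (suc i) n

IsFactor : Word → InfWord → Set
IsFactor x w = ∃[ i ] slice w i (length x) ≡ x

IsPrefix : Word → Word → Set
IsPrefix v u = Prefix _≡_ v u

IsRepetitionWith : Word → Word → Set
IsRepetitionWith x u =
  ¬ (u ≡ []) × ∃[ n ] ∃[ v ] (IsPrefix v u × x ≡ concat (replicate n u) ++ v)

Is3PlusRep : Word → Set
Is3PlusRep x = ∃[ u ] (IsRepetitionWith x u × 3 * length u < length x)

IsOverlap : Word → Set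
IsOverlap x = ∃[ u ] (IsRepetitionWith x u × 2 * length u < length x)

IsSquareWith : Word → Word → Set
IsSquareWith x u = ¬ (u ≡ []) × x ≡ u ++ u

IsSquare : Word → Set
IsSquare x = ∃[ u ] IsSquareWith x u

data Even : ℕ → Set where
  even-zero : Even zero
  even-ss   : ∀ {n} → Even n → Even (suc (suc n))

IsEvenPeriodSquare : Word → Set
IsEvenPeriodSquare x = ∃[ u ] (IsSquareWith x u × Even (length u))

ThreePlusFree : InfWord → Set
ThreePlusFree w = ∀ x → IsFactor x w → ¬ Is3PlusRep x

ExactlyN : (Word → Set) → ℕ → Set
ExactlyN P k = Σ (List Word) λ xs →
  length xs ≡ k × Unique xs × All P xs × (∀ z → P z → z ∈ xs)

ExactlyNFactors : InfWord → (Word → Set) → ℕ → Set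
ExactlyNFactors w P k = ExactlyN (λ x → IsFactor x w × P x) k

-- w = ψ(t), where t = φ^ω(a) for φ : a ↦ ada, b ↦ bcb, c ↦ adcda, d ↦ bcdcb, and ψ sends a, b to binary
-- words of length 23 and c, d to binary words of length 45.  Both morphisms are prefix and suffix codes, and
-- a window of length 2 (for φ) or 12 (for ψ) tells whether it starts a block.  So a long square of f(t)
-- desubstitutes: either its halves are aligned on blocks, giving a square of t of smaller period, or they
-- are shifted by exactly one block, and a finite check of these configurations gives a square of t or a
-- factor α v γ v β of t with (α, γ, β) ∈ {(c, a, c), (d, b, d)} of smaller period; such factors of t
-- desubstitute in the same way.  By induction on the period, t has neither squares nor such factors (short
-- periods are excluded on the factors of length 13 of t, which are enumerated by closing them under φ), so
-- w has no square of period ≥ 57.  The shorter squares, and the overlaps and 3⁺-repetitions (of period at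
-- most 3 once the squares are known), are read off the factors of length 112 of w, each of which lies in
-- ψ(v) for some factor v of length 7 of t.
module Submission where

open import Defs
open import Data.Product using (∃-syntax; _×_)
open import Relation.Nullary using (¬_)

open import Algebra.Definitions.RawMagma using (module _∣ˡ_)
open import Data.Bool using (Bool; true; false; _∧_; _∨_; not; T)
open import Data.Bool.ListAction using (all; any)
open import Data.Bool.Properties using (T-≡)
open import Data.Empty using (⊥; ⊥-elim)
open import Data.List using (List; []; _∷_; _++_; length; take; drop; concat; concatMap; replicate; [_])
open import Data.List.Membership.Propositional using (_∈_)
open import Data.List.Properties
  using (length-++; ++-assoc; ++-identityʳ; length-drop; length-take; take++drop≡id; take-all; take-take; concatMap-++)
open import Data.List.Relation.Binary.Prefix.Heterogeneous using ([])
open import Data.List.Relation.Binary.Prefix.Propositional.Properties using (Prefix-as-∣ˡ)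
open import Data.List.Relation.Unary.All using ([]; _∷_)
open import Data.List.Relation.Unary.AllPairs using ([]; _∷_)
open import Data.List.Relation.Unary.Any using (here; there)
open import Data.Nat
  using (ℕ; zero; suc; _+_; _*_; _∸_; _⊓_; _≤_; _<_; z≤n; s≤s; >-nonZero; _≤?_; _<?_; _<ᵇ_; _≡ᵇ_; _≤ᵇ_; pred)
open import Data.Nat.Induction using (<-rec)
open import Data.Nat.Properties
open import Data.Nat.Solver using (module +-*-Solver)
open import Data.Product using (∃; _,_; proj₁; proj₂)
open import Data.Sum using (_⊎_; inj₁; inj₂; [_,_]′)
open import Function.Bundles using (Equivalence)
open import Relation.Binary.Definitions using (tri<; tri≈; tri>)
open import Relation.Binary.PropositionalEquality
  using (_≡_; refl; sym; trans; cong; cong₂; subst; subst₂; module ≡-Reasoning)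
open import Relation.Nullary using (yes; no; Dec)

open import Algebra.Properties.CommutativeSemigroup +-commutativeSemigroup using (xy∙z≈xz∙y)
open +-*-Solver using (solve; _:+_; _:=_; con)

module _ {A : Set} where

  nth : A → List A → ℕ → A
  nth d []       _       = d
  nth d (x ∷ xs) zero    = x
  nth d (x ∷ xs) (suc k) = nth d xs k

  nth-++ʳ : ∀ d xs ys k → nth d (xs ++ ys) (length xs + k) ≡ nth d ys k
  nth-++ʳ d []       ys k = refl
  nth-++ʳ d (x ∷ xs) ys k = nth-++ʳ d xs ys k

  nth-++ˡ : ∀ d xs ys k → k < length xs → nth d (xs ++ ys) k ≡ nth d xs k
  nth-++ˡ d (x ∷ xs) ys zero    _         = refl
  nth-++ˡ d (x ∷ xs) ys (suc k) (s≤s k<n) = nth-++ˡ d xs ys k k<n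

  nth-drop : ∀ d xs m k → nth d (drop m xs) k ≡ nth d xs (m + k)
  nth-drop d []       zero    k = refl
  nth-drop d []       (suc m) k = refl
  nth-drop d (x ∷ xs) zero    k = refl
  nth-drop d (x ∷ xs) (suc m) k = nth-drop d xs m k

  nth-take : ∀ d xs m k → k < m → nth d (take m xs) k ≡ nth d xs k
  nth-take d []       (suc m) k       _         = refl
  nth-take d (x ∷ xs) (suc m) zero    _         = refl
  nth-take d (x ∷ xs) (suc m) (suc k) (s≤s k<m) = nth-take d xs m k k<m

  drop≡nth∷drop : ∀ d xs k → k < length xs → drop k xs ≡ nth d xs k ∷ drop (suc k) xs
  drop≡nth∷drop d (x ∷ xs) zero    _         = refl
  drop≡nth∷drop d (x ∷ xs) (suc k) (s≤s k<n) = drop≡nth∷drop d xs k k<n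

  take-++-length : ∀ (xs ys : List A) → take (length xs) (xs ++ ys) ≡ xs
  take-++-length []       ys = refl
  take-++-length (x ∷ xs) ys = cong (x ∷_) (take-++-length xs ys)

  drop-++-length : ∀ (xs ys : List A) → drop (length xs) (xs ++ ys) ≡ ys
  drop-++-length []       ys = refl
  drop-++-length (x ∷ xs) ys = drop-++-length xs ys

  take-++-≤ : ∀ m (xs ys : List A) → m ≤ length xs → take m (xs ++ ys) ≡ take m xs
  take-++-≤ zero    xs       ys _         = refl
  take-++-≤ (suc m) (x ∷ xs) ys (s≤s m≤n) = cong (x ∷_) (take-++-≤ m xs ys m≤n)

  length-take-≤ : ∀ m (xs : List A) → m ≤ length xs → length (take m xs) ≡ m
  length-take-≤ m xs m≤n = trans (length-take m xs) (m≤n⇒m⊓n≡m m≤n)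

  IsPrefixOf : List A → List A → Set
  IsPrefixOf xs ys = ∃ λ zs → xs ++ zs ≡ ys

  IsSuffixOf : List A → List A → Set
  IsSuffixOf xs ys = ∃ λ zs → zs ++ xs ≡ ys

  prefix-trans : ∀ {xs ys zs : List A} → IsPrefixOf xs ys → IsPrefixOf ys zs → IsPrefixOf xs zs
  prefix-trans {xs} (as , refl) (bs , refl) = as ++ bs , sym (++-assoc xs as bs)

  prefix⇒nth : ∀ d {xs ys} → IsPrefixOf xs ys → ∀ k → k < length xs → nth d xs k ≡ nth d ys k
  prefix⇒nth d {xs} (zs , refl) k k<n = sym (nth-++ˡ d xs zs k k<n)

  prefix⇒take : ∀ {xs ys : List A} m → IsPrefixOf xs ys → m ≤ length xs → take m xs ≡ take m ys
  prefix⇒take {xs} m (zs , refl) m≤n = sym (take-++-≤ m xs zs m≤n)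

  suffix⇒drop : ∀ {xs ys : List A} → IsSuffixOf xs ys → drop (length ys ∸ length xs) ys ≡ xs
  suffix⇒drop {xs} (zs , refl) = begin
    drop (length (zs ++ xs) ∸ length xs) (zs ++ xs) ≡⟨ cong (λ n → drop (n ∸ length xs) (zs ++ xs)) (length-++ zs) ⟩
    drop (length zs + length xs ∸ length xs) (zs ++ xs) ≡⟨ cong (λ n → drop n (zs ++ xs)) (m+n∸n≡m (length zs) (length xs)) ⟩
    drop (length zs) (zs ++ xs)                     ≡⟨ drop-++-length zs xs ⟩
    xs                                              ∎
    where open ≡-Reasoning

  pointwise⇒prefix⊎prefix : ∀ d xs ys →
    (∀ k → k < length xs → k < length ys → nth d xs k ≡ nth d ys k) → IsPrefixOf xs ys ⊎ IsPrefixOf ys xs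
  pointwise⇒prefix⊎prefix d []       ys       _  = inj₁ (ys , refl)
  pointwise⇒prefix⊎prefix d (x ∷ xs) []       _  = inj₂ (x ∷ xs , refl)
  pointwise⇒prefix⊎prefix d (x ∷ xs) (y ∷ ys) eq
    with eq 0 (s≤s z≤n) (s≤s z≤n) | pointwise⇒prefix⊎prefix d xs ys (λ k p q → eq (suc k) (s≤s p) (s≤s q))
  ... | refl | inj₁ (zs , e) = inj₁ (zs , cong (x ∷_) e)
  ... | refl | inj₂ (zs , e) = inj₂ (zs , cong (x ∷_) e)

  pointwise⇒≡ : ∀ d xs ys → length xs ≡ length ys → (∀ k → k < length xs → nth d xs k ≡ nth d ys k) → xs ≡ ys
  pointwise⇒≡ d []       []       _   _  = refl
  pointwise⇒≡ d (x ∷ xs) (y ∷ ys) len eq with eq 0 (s≤s z≤n)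
  ... | refl = cong (x ∷_) (pointwise⇒≡ d xs ys (suc-injective len) (λ k p → eq (suc k) (s≤s p)))

  pointwise⇒suffix : ∀ d xs ys m → m + length xs ≡ length ys →
    (∀ k → k < length xs → nth d xs k ≡ nth d ys (m + k)) → IsSuffixOf xs ys
  pointwise⇒suffix d xs ys m len eq = take m ys , trans (cong (take m ys ++_) (sym drop≡)) (take++drop≡id m ys)
    where
    length-drop-m : length (drop m ys) ≡ length xs
    length-drop-m = trans (length-drop m ys) (trans (cong (_∸ m) (sym len)) (m+n∸m≡n m (length xs)))
    drop≡ : drop m ys ≡ xs
    drop≡ = pointwise⇒≡ d (drop m ys) xs length-drop-m
      (λ k k<n → trans (nth-drop d ys m k) (sym (eq k (subst (k <_) length-drop-m k<n))))

module _ {A : Set} where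

  segment : (ℕ → A) → ℕ → ℕ → List A
  segment v i zero    = []
  segment v i (suc n) = v i ∷ segment v (suc i) n

  length-segment : ∀ (v : ℕ → A) i n → length (segment v i n) ≡ n
  length-segment v i zero    = refl
  length-segment v i (suc n) = cong suc (length-segment v (suc i) n)

  take-segment : ∀ (v : ℕ → A) i k n → k ≤ n → take k (segment v i n) ≡ segment v i k
  take-segment v i zero    n       _         = refl
  take-segment v i (suc k) (suc n) (s≤s k≤n) = cong (v i ∷_) (take-segment v (suc i) k n k≤n)

  drop-segment : ∀ (v : ℕ → A) i k n → drop k (segment v i n) ≡ segment v (i + k) (n ∸ k)
  drop-segment v i zero    n       = cong (λ j → segment v j n) (sym (+-identityʳ i))
  drop-segment v i (suc k) zero    = refl
  drop-segment v i (suc k) (suc n) = trans (drop-segment v (suc i) k n) (cong (λ j → segment v j (n ∸ k)) (sym (+-suc i k)))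

  take-drop-segment : ∀ (v : ℕ → A) i k m n → k + m ≤ n → take m (drop k (segment v i n)) ≡ segment v (i + k) m
  take-drop-segment v i k m n k+m≤n = trans (cong (take m) (drop-segment v i k n))
    (take-segment v (i + k) m (n ∸ k) (subst (_≤ n ∸ k) (m+n∸m≡n k m) (∸-monoˡ-≤ k k+m≤n)))

  nth-segment : ∀ d (v : ℕ → A) i n k → k < n → nth d (segment v i n) k ≡ v (i + k)
  nth-segment d v i (suc n) zero    _         = cong v (sym (+-identityʳ i))
  nth-segment d v i (suc n) (suc k) (s≤s k<n) = trans (nth-segment d v (suc i) n k k<n) (cong v (sym (+-suc i k)))

  segment-snoc : ∀ (v : ℕ → A) i n → segment v i (suc n) ≡ segment v i n ++ [ v (i + n) ]
  segment-snoc v i zero    = cong (λ j → v j ∷ []) (sym (+-identityʳ i))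
  segment-snoc v i (suc n) = cong (v i ∷_)
    (trans (segment-snoc v (suc i) n) (cong (λ j → segment v (suc i) n ++ [ v j ]) (sym (+-suc i n))))

  segment-cong : ∀ (v : ℕ → A) i j n → (∀ k → k < n → v (i + k) ≡ v (j + k)) → segment v i n ≡ segment v j n
  segment-cong v i j zero    _  = refl
  segment-cong v i j (suc n) eq = cong₂ _∷_
    (trans (cong v (sym (+-identityʳ i))) (trans (eq 0 (s≤s z≤n)) (cong v (+-identityʳ j))))
    (segment-cong v (suc i) (suc j) n
      (λ k k<n → trans (cong v (sym (+-suc i k))) (trans (eq (suc k) (s≤s k<n)) (cong v (+-suc j k)))))

  segment-shift : ∀ (v : ℕ → A) i q n → (∀ x → i ≤ x → x < i + n → v x ≡ v (x + q)) → segment v i n ≡ segment v (i + q) n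
  segment-shift v i q n per = segment-cong v i (i + q) n
    (λ k k<n → trans (per (i + k) (m≤m+n i k) (+-monoʳ-< i k<n)) (cong v (xy∙z≈xz∙y i k q)))

  segment≡take-drop : ∀ d (v : ℕ → A) i n xs m → (∀ k → k < n → v (i + k) ≡ nth d xs (m + k)) →
    m + n ≤ length xs → segment v i n ≡ take n (drop m xs)
  segment≡take-drop d v i zero    xs m _  _     = refl
  segment≡take-drop d v i (suc n) xs m eq m+n≤ =
    trans (cong₂ _∷_ head≡ tail≡) (cong (take (suc n)) (sym (drop≡nth∷drop d xs m m<len)))
    where
    m<len : m < length xs
    m<len = <-≤-trans (subst (m <_) (sym (+-suc m n)) (s≤s (m≤m+n m n))) m+n≤
    head≡ : v i ≡ nth d xs m
    head≡ = trans (cong v (sym (+-identityʳ i))) (trans (eq 0 (s≤s z≤n)) (cong (nth d xs) (+-identityʳ m)))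
    tail≡ : segment v (suc i) n ≡ take n (drop (suc m) xs)
    tail≡ = segment≡take-drop d v (suc i) n xs (suc m)
      (λ k k<n → trans (cong v (sym (+-suc i k))) (trans (eq (suc k) (s≤s k<n)) (cong (nth d xs) (+-suc m k))))
      (subst (_≤ length xs) (+-suc m n) m+n≤)

slice≡segment : ∀ (v : InfWord) i n → slice v i n ≡ segment v i n
slice≡segment v i zero    = refl
slice≡segment v i (suc n) = cong (v i ∷_) (slice≡segment v (suc i) n)

module _ {A B : Set} (g : A → List B) where

  concatMap-prefix : ∀ {xs ys} → IsPrefixOf xs ys → IsPrefixOf (concatMap g xs) (concatMap g ys)
  concatMap-prefix {xs} (zs , refl) = concatMap g zs , sym (concatMap-++ g xs zs)

  length-concatMap-≥ : ∀ m → (∀ x → m ≤ length (g x)) → ∀ xs → length xs * m ≤ length (concatMap g xs)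
  length-concatMap-≥ m long []       = z≤n
  length-concatMap-≥ m long (x ∷ xs) =
    subst (m + length xs * m ≤_) (sym (length-++ (g x))) (+-mono-≤ (long x) (length-concatMap-≥ m long xs))

module _ {A : Set} where

  power : List A → ℕ → List A
  power u n = concat (replicate n u)

  power-suc : ∀ u n → power u n ++ u ≡ power u (suc n)
  power-suc u zero    = sym (++-identityʳ u)
  power-suc u (suc n) = trans (++-assoc u (power u n) u) (cong (u ++_) (power-suc u n))

  power-+ : ∀ u m n → power u (m + n) ≡ power u m ++ power u n
  power-+ u zero    n = refl
  power-+ u (suc m) n = trans (cong (u ++_) (power-+ u m n)) (sym (++-assoc u (power u m) (power u n)))

  length-power-4 : ∀ u → length (power u 4) ≡ 4 * length u
  length-power-4 u = trans (length-++ u) (cong (length u +_) (trans (length-++ u)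
    (cong (length u +_) (trans (length-++ u) (cong (length u +_) (trans (length-++ u) (cong (length u +_) refl)))))))

  take-power-2 : ∀ u n → take (length u + length u) (power u (2 + n)) ≡ u ++ u
  take-power-2 u n = begin
    take (length u + length u) (u ++ (u ++ power u n)) ≡⟨ cong₂ take (sym (length-++ u)) (sym (++-assoc u u (power u n))) ⟩
    take (length (u ++ u)) ((u ++ u) ++ power u n)    ≡⟨ take-++-length (u ++ u) (power u n) ⟩
    u ++ u                                             ∎
    where open ≡-Reasoning

repetition-prefix : ∀ {x u : Word} → IsRepetitionWith x u → ∀ m → m ≤ length x → m ≤ length (power u 4) →
  take m x ≡ take m (power u 4)
repetition-prefix {x} {u} (_ , n , v , v⊑u , x≡) m m≤x m≤u⁴ =
  trans (prefix⇒take m x⊑uⁿ⁺⁵ m≤x) (sym (prefix⇒take m u⁴⊑uⁿ⁺⁵ m≤u⁴))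
  where
  rest = _∣ˡ_.quotient (Prefix-as-∣ˡ v⊑u)
  x⊑uⁿ⁺¹ : IsPrefixOf x (power u (suc n))
  x⊑uⁿ⁺¹ = rest , (begin
    x ++ rest                    ≡⟨ cong (_++ rest) x≡ ⟩
    (power u n ++ v) ++ rest     ≡⟨ ++-assoc (power u n) v rest ⟩
    power u n ++ (v ++ rest)     ≡⟨ cong (power u n ++_) (_∣ˡ_.equality (Prefix-as-∣ˡ v⊑u)) ⟩
    power u n ++ u               ≡⟨ power-suc u n ⟩
    power u (suc n)              ∎)
    where open ≡-Reasoning
  x⊑uⁿ⁺⁵ : IsPrefixOf x (power u (suc n + 4))
  x⊑uⁿ⁺⁵ = prefix-trans x⊑uⁿ⁺¹ (power u 4 , sym (power-+ u (suc n) 4))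
  u⁴⊑uⁿ⁺⁵ : IsPrefixOf (power u 4) (power u (suc n + 4))
  u⁴⊑uⁿ⁺⁵ = power u (suc n) , trans (sym (power-+ u 4 (suc n))) (cong (power u) (+-comm 4 (suc n)))

occurrence-prefix : ∀ (v : InfWord) i (x : Word) m → slice v i (length x) ≡ x → m ≤ length x → segment v i m ≡ take m x
occurrence-prefix v i x m occ m≤x =
  trans (sym (take-segment v i m (length x) m≤x)) (cong (take m) (trans (sym (slice≡segment v i (length x))) occ))

square-occurrence⇒periodic : ∀ (v : InfWord) i (u : Word) → segment v i (length u + length u) ≡ u ++ u →
  ∀ x → i ≤ x → x < i + length u → v x ≡ v (x + length u)
square-occurrence⇒periodic v i u occ x i≤x x<i+p with m≤n⇒∃[o]m+o≡n i≤x
... | k , refl = begin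
  v (i + k)                          ≡⟨ sym (nth-segment false v i (p + p) k k<2p) ⟩
  nth false (segment v i (p + p)) k  ≡⟨ cong (λ z → nth false z k) occ ⟩
  nth false (u ++ u) k               ≡⟨ nth-++ˡ false u u k k<p ⟩
  nth false u k                      ≡⟨ sym (nth-++ʳ false u u k) ⟩
  nth false (u ++ u) (p + k)         ≡⟨ cong (λ z → nth false z (p + k)) (sym occ) ⟩
  nth false (segment v i (p + p)) (p + k) ≡⟨ nth-segment false v i (p + p) (p + k) (+-monoʳ-< p k<p) ⟩
  v (i + (p + k))                    ≡⟨ cong v (trans (cong (i +_) (+-comm p k)) (sym (+-assoc i k p))) ⟩
  v (i + k + p)                      ∎
  where
  open ≡-Reasoning
  p = length u
  k<p : k < p
  k<p = +-cancelˡ-< i k p x<i+p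
  k<2p : k < p + p
  k<2p = <-≤-trans k<p (m≤m+n p p)

∧-elimˡ : ∀ {x y} → x ∧ y ≡ true → x ≡ true
∧-elimˡ {true} _ = refl

∧-elimʳ : ∀ {x y} → x ∧ y ≡ true → y ≡ true
∧-elimʳ {true} e = e

∧-intro : ∀ {x y} → x ≡ true → y ≡ true → x ∧ y ≡ true
∧-intro refl refl = refl

¬∧¬-elim : ∀ {x y} → not x ∧ not y ≡ true → x ≡ false × y ≡ false
¬∧¬-elim {false} {false} _ = refl , refl

∨-resolveˡ : ∀ {x y} → x ∨ y ≡ true → x ≡ false → y ≡ true
∨-resolveˡ {false} e refl = e

¬∨-modusPonens : ∀ {x y} → not x ∨ y ≡ true → x ≡ true → y ≡ true
¬∨-modusPonens {true} e refl = e

true≢false : ∀ {x} → x ≡ true → x ≡ false → ⊥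
true≢false refl ()

allBelow : ℕ → (ℕ → Bool) → Bool
allBelow zero    P = true
allBelow (suc n) P = allBelow n P ∧ P n

allBelow-sound : ∀ n P → allBelow n P ≡ true → ∀ k → k < n → P k ≡ true
allBelow-sound (suc n) P all k k<1+n with m≤n⇒m<n∨m≡n (≤-pred k<1+n)
... | inj₁ k<n  = allBelow-sound n P (∧-elimˡ all) k k<n
... | inj₂ refl = ∧-elimʳ {allBelow n P} all

record BoolEq (A : Set) : Set where
  field
    _==_     : A → A → Bool
    ==-sound : ∀ x y → x == y ≡ true → x ≡ y
    ==-refl  : ∀ x → x == x ≡ true

open BoolEq {{...}} public

==-complete : ∀ {A : Set} {{_ : BoolEq A}} {x y : A} → x ≡ y → x == y ≡ true
==-complete {x = x} refl = ==-refl x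

module _ {A : Set} {{_ : BoolEq A}} where

  _∈ᵇ_ : A → List A → Bool
  x ∈ᵇ xs = any (x ==_) xs

  ∈ᵇ-sound : ∀ x xs → x ∈ᵇ xs ≡ true → x ∈ xs
  ∈ᵇ-sound x (y ∷ ys) mem with x == y in eq
  ... | true  = here (==-sound x y eq)
  ... | false = there (∈ᵇ-sound x ys mem)

  all-∈ᵇ : ∀ (P : A → Bool) xs → all P xs ≡ true → ∀ x → x ∈ᵇ xs ≡ true → P x ≡ true
  all-∈ᵇ P (y ∷ ys) all-P x mem with x == y in eq
  ... | true  = subst (λ z → P z ≡ true) (sym (==-sound x y eq)) (∧-elimˡ all-P)
  ... | false = all-∈ᵇ P ys (∧-elimʳ {P y} all-P) x mem

  eqList : List A → List A → Bool
  eqList []       []       = true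
  eqList (x ∷ xs) (y ∷ ys) = x == y ∧ eqList xs ys
  eqList _        _        = false

  eqList-sound : ∀ xs ys → eqList xs ys ≡ true → xs ≡ ys
  eqList-sound []       []       _  = refl
  eqList-sound (x ∷ xs) (y ∷ ys) eq = cong₂ _∷_ (==-sound x y (∧-elimˡ eq)) (eqList-sound xs ys (∧-elimʳ {x == y} eq))

  eqList-refl : ∀ xs → eqList xs xs ≡ true
  eqList-refl []       = refl
  eqList-refl (x ∷ xs) = ∧-intro (==-refl x) (eqList-refl xs)

  instance
    BoolEq-List : BoolEq (List A)
    BoolEq-List = record { _==_ = eqList ; ==-sound = eqList-sound ; ==-refl = eqList-refl }

instance
  BoolEq-Bool : BoolEq Bool
  BoolEq-Bool = record { _==_ = _==ᵇ_ ; ==-sound = sound ; ==-refl = refl′ }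
    where
    _==ᵇ_ : Bool → Bool → Bool
    true  ==ᵇ true  = true
    false ==ᵇ false = true
    _     ==ᵇ _     = false
    sound : ∀ x y → x ==ᵇ y ≡ true → x ≡ y
    sound true  true  _ = refl
    sound false false _ = refl
    refl′ : ∀ x → x ==ᵇ x ≡ true
    refl′ true  = refl
    refl′ false = refl

module PrefixLimit {A : Set} (d : A) (P : ℕ → List A)
  (P-mono : ∀ n → IsPrefixOf (P n) (P (suc n))) (P-long : ∀ n → n < length (P n)) where

  limit : ℕ → A
  limit y = nth d (P (suc y)) y

  prefix-≤ : ∀ {m n} → m ≤ n → IsPrefixOf (P m) (P n)
  prefix-≤ {n = zero}  z≤n    = [] , ++-identityʳ _
  prefix-≤ {n = suc n} m≤1+n with m≤n⇒m<n∨m≡n m≤1+n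
  ... | inj₁ m<1+n = prefix-trans (prefix-≤ (≤-pred m<1+n)) (P-mono n)
  ... | inj₂ refl  = [] , ++-identityʳ _

  limit-nth : ∀ n y → y < length (P n) → limit y ≡ nth d (P n) y
  limit-nth n y y<len with n ≤? suc y
  ... | yes n≤1+y = sym (prefix⇒nth d (prefix-≤ n≤1+y) y y<len)
  ... | no  n≰1+y = prefix⇒nth d (prefix-≤ (<⇒≤ (≰⇒> n≰1+y))) y (<-trans (n<1+n y) (P-long (suc y)))

  take≡segment : ∀ n k → k ≤ length (P n) → take k (P n) ≡ segment limit 0 k
  take≡segment n k k≤len = sym (segment≡take-drop d limit 0 k (P n) 0 (λ j j<k → limit-nth n j (<-≤-trans j<k k≤len)) k≤len)

module MorphicImage {A : Set} (d : A) (P : ℕ → List A)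
  (P-mono : ∀ n → IsPrefixOf (P n) (P (suc n))) (P-long : ∀ n → n < length (P n))
  {B : Set} (dB : B) (g : A → List B) (g-nonempty : ∀ x → 1 ≤ length (g x)) where

  open PrefixLimit d P P-mono P-long

  imageChain : ℕ → List B
  imageChain n = concatMap g (P n)

  imageChain-long : ∀ n → n < length (imageChain n)
  imageChain-long n = <-≤-trans (P-long n)
    (subst (_≤ length (imageChain n)) (*-identityʳ (length (P n))) (length-concatMap-≥ g 1 g-nonempty (P n)))

  module Image = PrefixLimit dB imageChain (λ n → concatMap-prefix g (P-mono n)) imageChain-long

  blockStart : ℕ → ℕ
  blockStart j = length (concatMap g (segment limit 0 j))

  blockStart-suc : ∀ j → blockStart (suc j) ≡ blockStart j + length (g (limit j))
  blockStart-suc j = begin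
    length (concatMap g (segment limit 0 (suc j)))                ≡⟨ cong (λ xs → length (concatMap g xs)) (segment-snoc limit 0 j) ⟩
    length (concatMap g (segment limit 0 j ++ [ limit j ]))       ≡⟨ cong length (concatMap-++ g (segment limit 0 j) [ limit j ]) ⟩
    length (concatMap g (segment limit 0 j) ++ (g (limit j) ++ [])) ≡⟨ length-++ (concatMap g (segment limit 0 j)) ⟩
    blockStart j + length (g (limit j) ++ [])                     ≡⟨ cong (λ xs → blockStart j + length xs) (++-identityʳ (g (limit j))) ⟩
    blockStart j + length (g (limit j))                           ∎
    where open ≡-Reasoning

  image-block : ∀ j r → r < length (g (limit j)) → Image.limit (blockStart j + r) ≡ nth dB (g (limit j)) r
  image-block j r r<len = trans (Image.limit-nth (suc j) (blockStart j + r) in-range) nth≡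
    where
    rest : List A
    rest = drop (suc j) (P (suc j))
    P≡ : P (suc j) ≡ segment limit 0 j ++ (limit j ∷ rest)
    P≡ = begin
      P (suc j)                                     ≡⟨ sym (take++drop≡id (suc j) (P (suc j))) ⟩
      take (suc j) (P (suc j)) ++ rest              ≡⟨ cong (_++ rest) (take≡segment (suc j) (suc j) (<⇒≤ (P-long (suc j)))) ⟩
      segment limit 0 (suc j) ++ rest               ≡⟨ cong (_++ rest) (segment-snoc limit 0 j) ⟩
      (segment limit 0 j ++ [ limit j ]) ++ rest    ≡⟨ ++-assoc (segment limit 0 j) [ limit j ] rest ⟩
      segment limit 0 j ++ (limit j ∷ rest)         ∎
      where open ≡-Reasoning
    image≡ : imageChain (suc j) ≡ concatMap g (segment limit 0 j) ++ (g (limit j) ++ concatMap g rest)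
    image≡ = trans (cong (concatMap g) P≡) (concatMap-++ g (segment limit 0 j) (limit j ∷ rest))
    nth≡ : nth dB (imageChain (suc j)) (blockStart j + r) ≡ nth dB (g (limit j)) r
    nth≡ = trans (cong (λ xs → nth dB xs (blockStart j + r)) image≡)
      (trans (nth-++ʳ dB (concatMap g (segment limit 0 j)) _ r) (nth-++ˡ dB (g (limit j)) _ r r<len))
    in-range : blockStart j + r < length (imageChain (suc j))
    in-range = subst (blockStart j + r <_) (sym (cong length image≡))
      (subst (blockStart j + r <_) (sym (length-++ (concatMap g (segment limit 0 j))))
        (+-monoʳ-< (blockStart j) (<-≤-trans r<len (subst (length (g (limit j)) ≤_) (sym (length-++ (g (limit j)))) (m≤m+n _ _)))))

-- f(α) = x y, f(β) = z s and f(γ) = z v y, where |x| = r > 0, |y| = e1, |z| = e2 < |f(β)| and |v| = δ.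
record ShiftFit {A B : Set} (dB : B) (f : A → List B) (δ : ℕ) (α γ β : A) (e1 e2 r : ℕ) : Set where
  field
    len-α  : r + e1 ≡ length (f α)
    r-pos  : 1 ≤ r
    e2<β   : e2 < length (f β)
    len-γ  : e1 + e2 + δ ≡ length (f γ)
    suffix : ∀ k → k < e1 → nth dB (f α) (r + k) ≡ nth dB (f γ) (e2 + δ + k)
    prefix : ∀ k → k < e2 → nth dB (f β) k ≡ nth dB (f γ) k

  r≡ : r ≡ length (f α) ∸ e1
  r≡ = trans (sym (m+n∸n≡m r e1)) (cong (_∸ e1) len-α)

  e2≡ : e2 ≡ length (f γ) ∸ e1 ∸ δ
  e2≡ = begin
    e2                         ≡⟨ sym (m+n∸n≡m e2 δ) ⟩
    e2 + δ ∸ δ                 ≡⟨ cong (_∸ δ) (sym (m+n∸m≡n e1 (e2 + δ))) ⟩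
    e1 + (e2 + δ) ∸ e1 ∸ δ     ≡⟨ cong (λ n → n ∸ e1 ∸ δ) (trans (sym (+-assoc e1 e2 δ)) len-γ) ⟩
    length (f γ) ∸ e1 ∸ δ      ∎
    where open ≡-Reasoning

-- Block decomposition of u = f(t₀) f(t₁) f(t₂) ⋯, the block f(tⱼ) starting at position S j

module Blocks {A B : Set} (dB : B) (f : A → List B) (t : ℕ → A) (u : ℕ → B)
  (S : ℕ → ℕ) (S-zero : S 0 ≡ 0) (S-suc : ∀ j → S (suc j) ≡ S j + length (f (t j)))
  (u-block : ∀ j r → r < length (f (t j)) → u (S j + r) ≡ nth dB (f (t j)) r)
  (f-long : ∀ x → 2 ≤ length (f x))
  where

  blockLen : ℕ → ℕ
  blockLen j = length (f (t j))

  blockLen-pos : ∀ j → 0 < blockLen j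
  blockLen-pos j = ≤-trans (s≤s z≤n) (f-long (t j))

  S-step : ∀ j → S j + 2 ≤ S (suc j)
  S-step j = subst (S j + 2 ≤_) (sym (S-suc j)) (+-monoʳ-≤ (S j) (f-long (t j)))

  S-gap : ∀ j k → S j + (k + k) ≤ S (j + k)
  S-gap j zero    = subst (λ i → S j + 0 ≤ S i) (sym (+-identityʳ j)) (≤-reflexive (+-identityʳ (S j)))
  S-gap j (suc k) = begin
    S j + (suc k + suc k) ≡⟨ solve 2 (λ x y → x :+ ((con 1 :+ y) :+ (con 1 :+ y)) := (x :+ (y :+ y)) :+ con 2) refl (S j) k ⟩
    S j + (k + k) + 2     ≤⟨ +-monoˡ-≤ 2 (S-gap j k) ⟩
    S (j + k) + 2         ≤⟨ S-step (j + k) ⟩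
    S (suc (j + k))       ≡⟨ cong S (sym (+-suc j k)) ⟩
    S (j + suc k)         ∎
    where open ≤-Reasoning

  index<position : ∀ j r x → S j + r ≡ suc x → j < suc x
  index<position zero    r x _ = s≤s z≤n
  index<position (suc j) r x e = begin-strict
    suc j            <⟨ m<m+n (suc j) (s≤s z≤n) ⟩
    suc j + suc j    ≤⟨ subst (λ z → z + (suc j + suc j) ≤ S (suc j)) S-zero (S-gap 0 (suc j)) ⟩
    S (suc j)        ≤⟨ m≤m+n _ r ⟩
    S (suc j) + r    ≡⟨ e ⟩
    suc x            ∎
    where open ≤-Reasoning

  S-mono-≤ : ∀ {j k} → j ≤ k → S j ≤ S k
  S-mono-≤ {j} j≤k with m≤n⇒∃[o]m+o≡n j≤k
  ... | d , refl = ≤-trans (m≤m+n (S j) (d + d)) (S-gap j d)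

  S-mono-< : ∀ {j k} → j < k → S j < S k
  S-mono-< {j} j<k = ≤-trans (≤-trans (n≤1+n (suc (S j))) (subst (_≤ S (suc j)) (+-comm (S j) 2) (S-step j))) (S-mono-≤ j<k)

  S-cancel-≤ : ∀ {j k} → S j ≤ S k → j ≤ k
  S-cancel-≤ {j} {k} Sj≤Sk with j ≤? k
  ... | yes j≤k = j≤k
  ... | no  j≰k = ⊥-elim (<⇒≱ (S-mono-< (≰⇒> j≰k)) Sj≤Sk)

  S-cancel-< : ∀ {j k} → S j < S k → j < k
  S-cancel-< {j} {k} Sj<Sk with j <? k
  ... | yes j<k = j<k
  ... | no  j≮k = ⊥-elim (<⇒≱ Sj<Sk (S-mono-≤ (≮⇒≥ j≮k)))

  locate : ∀ x → ∃ λ j → ∃ λ r → r < blockLen j × S j + r ≡ x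
  locate zero = 0 , 0 , blockLen-pos 0 , trans (+-identityʳ (S 0)) S-zero
  locate (suc x) with locate x
  ... | j , r , r<len , e with suc r <? blockLen j
  ...   | yes 1+r<len = j , suc r , 1+r<len , trans (+-suc (S j) r) (cong suc e)
  ...   | no  1+r≮len = suc j , 0 , blockLen-pos (suc j) , (begin
    S (suc j) + 0   ≡⟨ +-identityʳ _ ⟩
    S (suc j)       ≡⟨ S-suc j ⟩
    S j + blockLen j ≡⟨ cong (S j +_) (sym (≤-antisym r<len (≮⇒≥ 1+r≮len))) ⟩
    S j + suc r     ≡⟨ +-suc (S j) r ⟩
    suc (S j + r)   ≡⟨ cong suc e ⟩
    suc x           ∎)
    where open ≡-Reasoning

  enclosingBlock : ∀ N a → S a ≤ N → ∃ λ h → S (a + h) ≤ N × N < S (suc (a + h))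
  enclosingBlock N a Sa≤N with locate N
  ... | j , r , r<len , refl = j ∸ a , subst (λ i → S i ≤ S j + r) (sym a+h≡j) (m≤m+n (S j) r)
      , subst (λ i → S j + r < S (suc i)) (sym a+h≡j) N<S[1+j]
    where
    N<S[1+j] : S j + r < S (suc j)
    N<S[1+j] = subst (S j + r <_) (sym (S-suc j)) (+-monoʳ-< (S j) r<len)
    a≤j : a ≤ j
    a≤j = ≤-pred (S-cancel-< (≤-<-trans Sa≤N N<S[1+j]))
    a+h≡j : a + (j ∸ a) ≡ j
    a+h≡j = m+[n∸m]≡n a≤j

  blockStart-offset≡0 : ∀ k j r → S k ≡ S j + r → r < blockLen j → r ≡ 0
  blockStart-offset≡0 k j r Sk≡ r<len = +-cancelˡ-≡ (S j) r 0 (begin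
    S j + r   ≡⟨ sym Sk≡ ⟩
    S k       ≡⟨ cong S k≡j ⟩
    S j       ≡⟨ sym (+-identityʳ (S j)) ⟩
    S j + 0   ∎)
    where
    open ≡-Reasoning
    k<1+j : k < suc j
    k<1+j = S-cancel-< (subst (_< S (suc j)) (sym Sk≡) (subst (S j + r <_) (sym (S-suc j)) (+-monoʳ-< (S j) r<len)))
    k≡j : k ≡ j
    k≡j = ≤-antisym (≤-pred k<1+j) (S-cancel-≤ (≤-trans (m≤m+n (S j) r) (≤-reflexive (sym Sk≡))))

  nth-image : ∀ K j m → m < length (concatMap f (segment t j K)) → u (S j + m) ≡ nth dB (concatMap f (segment t j K)) m
  nth-image (suc K) j m m<len with m <? blockLen j
  ... | yes m<blk = trans (u-block j m m<blk) (sym (nth-++ˡ dB (f (t j)) _ m m<blk))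
  ... | no  m≮blk with m≤n⇒∃[o]m+o≡n (≮⇒≥ m≮blk)
  ...   | m′ , refl = trans (cong u (trans (sym (+-assoc (S j) (blockLen j) m′)) (cong (_+ m′) (sym (S-suc j)))))
                        (trans (nth-image K (suc j) m′ m′<len) (sym (nth-++ʳ dB (f (t j)) _ m′)))
    where
    m′<len : m′ < length (concatMap f (segment t (suc j) K))
    m′<len = +-cancelˡ-< (blockLen j) m′ _ (subst (blockLen j + m′ <_) (length-++ (f (t j))) m<len)

  segment-image : ∀ K j r n → r + n ≤ length (concatMap f (segment t j K)) →
    segment u (S j + r) n ≡ take n (drop r (concatMap f (segment t j K)))
  segment-image K j r n r+n≤ = segment≡take-drop dB u (S j + r) n (concatMap f (segment t j K)) r
    (λ k k<n → trans (cong u (+-assoc (S j) r k)) (nth-image K j (r + k) (<-≤-trans (+-monoʳ-< r k<n) r+n≤))) r+n≤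

  IsBlockStart : ℕ → Set
  IsBlockStart y = ∃ λ k → S k ≡ y

  PeriodicOn : ℕ → ℕ → ℕ → Set
  PeriodicOn p i0 E = ∀ x → i0 ≤ x → x < E → u x ≡ u (x + p)

  periodic-shift : ∀ {p i0 E} → PeriodicOn p i0 E → ∀ y k → i0 ≤ y → y + k < E → u (y + k) ≡ u (y + p + k)
  periodic-shift {p} per y k i0≤y y+k<E =
    trans (per (y + k) (≤-trans i0≤y (m≤m+n y k)) y+k<E) (cong u (xy∙z≈xz∙y y k p))

  SquareAt : ℕ → ℕ → Set
  SquareAt j q = 1 ≤ q × (∀ x → j ≤ x → x < j + q → t x ≡ t (x + q))

  image-long : ∀ m → (∀ x → m ≤ length (f x)) → ∀ j r K n → r < blockLen j → n ≤ K * m →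
    r + n ≤ length (concatMap f (segment t j (suc K)))
  image-long m f-≥m j r K n r<ℓ n≤Km = begin
    r + n                                                   ≤⟨ +-mono-≤ (<⇒≤ r<ℓ) n≤Km ⟩
    blockLen j + K * m                                      ≤⟨ +-monoʳ-≤ (blockLen j) (subst (λ k → k * m ≤ length (concatMap f (segment t (suc j) K))) (length-segment t (suc j) K)
                                                                 (length-concatMap-≥ f m f-≥m (segment t (suc j) K))) ⟩
    blockLen j + length (concatMap f (segment t (suc j) K)) ≡⟨ sym (length-++ (f (t j))) ⟩
    length (concatMap f (segment t j (suc K)))              ∎
    where open ≤-Reasoning

  module Windows {{_ : BoolEq A}} (dA : A) (K : ℕ) (factors : List (List A))
    (n m : ℕ) (f-≥m : ∀ x → m ≤ length (f x)) (n≤Km : n ≤ K * m) where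

    -- P r holds on each window of length n of f(v) starting at an offset r inside the first block, for every
    -- listed v; when the factors of length K + 1 of t are listed, this covers every window of u.
    windowsᵇ : (ℕ → List B → Bool) → Bool
    windowsᵇ P = all (λ v → allBelow (length (f (nth dA v 0))) (λ r → P r (take n (drop r (concatMap f v))))) factors

    window-in-block : ∀ P → windowsᵇ P ≡ true → ∀ j r → r < blockLen j → segment t j (suc K) ∈ᵇ factors ≡ true →
      P r (segment u (S j + r) n) ≡ true
    window-in-block P all-ok j r r<ℓ factor =
      subst (λ w → P r w ≡ true) (sym (segment-image (suc K) j r n (image-long m f-≥m j r K n r<ℓ n≤Km)))
        (allBelow-sound _ _ (all-∈ᵇ _ factors all-ok (segment t j (suc K)) factor) r r<ℓ)

    module _ (factor : ∀ j → segment t j (suc K) ∈ᵇ factors ≡ true) where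

      every-window : ∀ P → windowsᵇ P ≡ true → ∀ y → ∃ λ j → ∃ λ r → S j + r ≡ y × r < blockLen j × P r (segment u y n) ≡ true
      every-window P all-ok y with locate y
      ... | j , r , r<ℓ , refl = j , r , refl , r<ℓ , window-in-block P all-ok j r r<ℓ (factor j)

      detectsStart : (List B → Bool) → ℕ → List B → Bool
      detectsStart isStartᵇ r w = isStartᵇ w == (r ≡ᵇ 0)

      synchronizing-from : (isStartᵇ : List B → Bool) → windowsᵇ (detectsStart isStartᵇ) ≡ true →
        ∀ y z → (∀ r → r < n → u (y + r) ≡ u (z + r)) → IsBlockStart y → IsBlockStart z
      synchronizing-from isStartᵇ all-ok y z y≈z (k , Sk≡y)
        with every-window (detectsStart isStartᵇ) all-ok y | every-window (detectsStart isStartᵇ) all-ok z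
      ... | jy , ry , Sjy+ry≡y , ry<ℓ , at-y | jz , rz , Sjz+rz≡z , rz<ℓ , at-z =
        jz , trans (sym (+-identityʳ (S jz))) (trans (cong (S jz +_) (sym rz≡0)) Sjz+rz≡z)
        where
        ry≡0 : ry ≡ 0
        ry≡0 = blockStart-offset≡0 k jy ry (trans Sk≡y (sym Sjy+ry≡y)) ry<ℓ
        start-y : isStartᵇ (segment u y n) ≡ true
        start-y = trans (==-sound _ _ at-y) (cong (_≡ᵇ 0) ry≡0)
        start-z : isStartᵇ (segment u z n) ≡ true
        start-z = trans (cong isStartᵇ (sym (segment-cong u y z n y≈z))) start-y
        rz≡0 : rz ≡ 0
        rz≡0 = ≡ᵇ⇒≡ rz 0 (Equivalence.from T-≡ (trans (sym (==-sound _ _ at-z)) start-z))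

  module Desubstitution (M : ℕ) (f-short : ∀ x → length (f x) ≤ M) (L : ℕ)
    (synchronizing : ∀ y z → (∀ r → r < L → u (y + r) ≡ u (z + r)) → IsBlockStart y → IsBlockStart z)
    (prefix-code : ∀ x y → IsPrefixOf (f x) (f y) → x ≡ y)
    (suffix-code : ∀ x y → IsSuffixOf (f x) (f y) → x ≡ y) where

    blocks-agree⇒≡ : ∀ j j′ → (∀ k → k < blockLen j → k < blockLen j′ → u (S j + k) ≡ u (S j′ + k)) → t j ≡ t j′
    blocks-agree⇒≡ j j′ agree with pointwise⇒prefix⊎prefix dB (f (t j)) (f (t j′))
      (λ k k<ℓ k<ℓ′ → trans (sym (u-block j k k<ℓ)) (trans (agree k k<ℓ k<ℓ′) (u-block j′ k k<ℓ′)))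
    ... | inj₁ prefix = prefix-code (t j) (t j′) prefix
    ... | inj₂ prefix = sym (prefix-code (t j′) (t j) prefix)

    record Preceding (i0 a e1 : ℕ) : Set where
      field
        a₀ r    : ℕ
        a≡      : a ≡ suc a₀
        α-start : S a₀ + r ≡ i0
        α-len   : r + e1 ≡ blockLen a₀
        r-pos   : 1 ≤ r

    -- a is the first block starting at or after i0; synchronization makes S a + p the start of a block a′.
    record Anchor (i0 E p : ℕ) : Set where
      field
        a e1 a′ : ℕ
        Sa      : S a ≡ i0 + e1
        Sa′     : S a′ ≡ S a + p
        fits    : S a + L ≤ E
        before  : e1 ≡ 0 ⊎ Preceding i0 a e1

    anchor-from : ∀ {i0 E p} → PeriodicOn p i0 E → i0 + (M + L) ≤ suc E →
      ∀ a e1 → S a ≡ i0 + e1 → e1 < M → e1 ≡ 0 ⊎ Preceding i0 a e1 → Anchor i0 E p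
    anchor-from {i0} {E} {p} per long a e1 Sa e1<M before = record
      { a = a ; e1 = e1 ; a′ = proj₁ copy ; Sa = Sa ; Sa′ = proj₂ copy ; fits = fits ; before = before }
      where
      fits : S a + L ≤ E
      fits = ≤-pred (begin
        suc (S a + L)       ≡⟨ cong (λ z → suc (z + L)) Sa ⟩
        suc (i0 + e1 + L)   ≡⟨ cong suc (+-assoc i0 e1 L) ⟩
        suc (i0 + (e1 + L)) ≡⟨ sym (+-suc i0 (e1 + L)) ⟩
        i0 + suc (e1 + L)   ≤⟨ +-monoʳ-≤ i0 (+-monoˡ-≤ L e1<M) ⟩
        i0 + (M + L)        ≤⟨ long ⟩
        suc E               ∎)
        where open ≤-Reasoning
      i0≤Sa : i0 ≤ S a
      i0≤Sa = ≤-trans (m≤m+n i0 e1) (≤-reflexive (sym Sa))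
      copy : IsBlockStart (S a + p)
      copy = synchronizing (S a) (S a + p)
        (λ r r<L → periodic-shift per (S a) r i0≤Sa (<-≤-trans (+-monoʳ-< (S a) r<L) fits)) (a , refl)

    anchor : ∀ {i0 E p} → PeriodicOn p i0 E → i0 + (M + L) ≤ suc E → Anchor i0 E p
    anchor {i0} per long with locate i0
    ... | j , zero , r<ℓ , e = anchor-from per long j 0
          (trans (sym (+-identityʳ (S j))) (trans e (sym (+-identityʳ i0))))
          (<-≤-trans (blockLen-pos j) (f-short (t j))) (inj₁ refl)
    ... | j , suc r , r<ℓ , e = anchor-from per long (suc j) e1 Sa (<-≤-trans e1<ℓ (f-short (t j)))
          (inj₂ (record { a₀ = j ; r = suc r ; a≡ = refl ; α-start = e ; α-len = r+e1≡ℓ ; r-pos = s≤s z≤n }))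
      where
      e1 : ℕ
      e1 = blockLen j ∸ suc r
      r+e1≡ℓ : suc r + e1 ≡ blockLen j
      r+e1≡ℓ = m+[n∸m]≡n (<⇒≤ r<ℓ)
      Sa : S (suc j) ≡ i0 + e1
      Sa = trans (S-suc j) (trans (cong (S j +_) (sym r+e1≡ℓ)) (trans (sym (+-assoc (S j) (suc r) e1)) (cong (_+ e1) e)))
      e1<ℓ : e1 < blockLen j
      e1<ℓ = subst (e1 <_) r+e1≡ℓ (s≤s (m≤n+m e1 r))

    toPreceding : ∀ {i0 a e1} → e1 ≡ 0 ⊎ Preceding i0 a e1 → (e1 ≡ 0 → 1 ≤ i0) → S a ≡ i0 + e1 → Preceding i0 a e1
    toPreceding (inj₂ prec) _ _ = prec
    toPreceding {i0} {zero} (inj₁ refl) i0-pos Sa = ⊥-elim (1+n≰n (subst (1 ≤_) (trans (sym (+-identityʳ i0)) (trans (sym Sa) S-zero)) (i0-pos refl)))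
    toPreceding {i0} {suc a₀} (inj₁ refl) _ Sa = record
      { a₀ = a₀ ; r = blockLen a₀ ; a≡ = refl ; α-start = trans (sym (S-suc a₀)) (trans Sa (+-identityʳ i0))
      ; α-len = +-identityʳ (blockLen a₀) ; r-pos = blockLen-pos a₀ }

    matching-blocks : ∀ {p i0 E a a′} → PeriodicOn p i0 E → i0 ≤ S a → S a′ ≡ S a + p → ∀ m → S (a + m) ≤ E →
      S (a′ + m) ≡ S (a + m) + p × (∀ k → k < m → t (a + k) ≡ t (a′ + k))
    matching-blocks {p} {a = a} {a′} per i0≤Sa Sa′ zero _ =
      trans (cong S (+-identityʳ a′)) (trans Sa′ (cong (λ i → S i + p) (sym (+-identityʳ a)))) , λ k ()
    matching-blocks {p} {i0} {E} {a} {a′} per i0≤Sa Sa′ (suc m) S[a+1+m]≤E = starts , letters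
      where
      j  = a + m
      j′ = a′ + m
      S[1+j]≤E : S (suc j) ≤ E
      S[1+j]≤E = subst (λ i → S i ≤ E) (+-suc a m) S[a+1+m]≤E
      previous = matching-blocks per i0≤Sa Sa′ m (≤-trans (S-mono-≤ (n≤1+n j)) S[1+j]≤E)
      Sj′ : S j′ ≡ S j + p
      Sj′ = proj₁ previous
      tj≡tj′ : t j ≡ t j′
      tj≡tj′ = blocks-agree⇒≡ j j′ λ k k<ℓ _ → trans
        (periodic-shift per (S j) k (≤-trans i0≤Sa (S-mono-≤ (m≤m+n a m)))
          (<-≤-trans (+-monoʳ-< (S j) k<ℓ) (subst (_≤ E) (S-suc j) S[1+j]≤E)))
        (cong (λ i → u (i + k)) (sym Sj′))
      starts : S (a′ + suc m) ≡ S (a + suc m) + p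
      starts = begin
        S (a′ + suc m)          ≡⟨ cong S (+-suc a′ m) ⟩
        S (suc j′)              ≡⟨ S-suc j′ ⟩
        S j′ + blockLen j′      ≡⟨ cong₂ _+_ Sj′ (cong (λ x → length (f x)) (sym tj≡tj′)) ⟩
        S j + p + blockLen j    ≡⟨ xy∙z≈xz∙y (S j) p (blockLen j) ⟩
        S j + blockLen j + p    ≡⟨ cong (_+ p) (sym (S-suc j)) ⟩
        S (suc j) + p           ≡⟨ cong (λ i → S i + p) (sym (+-suc a m)) ⟩
        S (a + suc m) + p       ∎
        where open ≡-Reasoning
      letters : ∀ k → k < suc m → t (a + k) ≡ t (a′ + k)
      letters k k<1+m with m≤n⇒m<n∨m≡n (≤-pred k<1+m)
      ... | inj₁ k<m  = proj₂ previous k k<m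
      ... | inj₂ refl = tj≡tj′

    -- The copies of the blocks a, …, a + h - 1 start one block late: γ = a + h has no copy, and the blocks
    -- α = a - 1 (around i0) and β = a + h + 1 + h (around E + p) overlap f(γ) as described by ShiftFit.
    record OneBlockShift (i0 E p δ : ℕ) : Set where
      field
        a h e1 e2 : ℕ
        preceding : Preceding i0 a e1
        end-γ     : S (a + h) + e2 ≡ E
        len-γ     : e1 + e2 + δ ≡ blockLen (a + h)
        start-β   : S (a + suc h + h) ≡ S (a + h) + p
        copies    : ∀ k → k < h → t (a + k) ≡ t (a + suc h + k)
        e2<β      : e2 < blockLen (a + suc h + h)
        suffix    : ∀ k → k < e1 → nth dB (f (t (Preceding.a₀ preceding))) (Preceding.r preceding + k)
                                     ≡ nth dB (f (t (a + h))) (e2 + δ + k)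
        prefix    : ∀ k → k < e2 → nth dB (f (t (a + suc h + h))) k ≡ nth dB (f (t (a + h))) k
        1+h<p     : suc h < p

    data Outcome (i0 E p δ : ℕ) : Set where
      square  : δ ≡ 0 → ∀ a h → h < p → SquareAt a h → Outcome i0 E p δ
      shifted : OneBlockShift i0 E p δ → Outcome i0 E p δ

    period-bound : ∀ a q p → S (a + q) ≡ S a + p → 1 ≤ q → q < p
    period-bound a q p S[a+q]≡ q-pos =
      <-≤-trans (m<m+n q q-pos) (+-cancelˡ-≤ (S a) (q + q) p (≤-trans (S-gap a q) (≤-reflexive S[a+q]≡)))

    -- For δ = 0 the stretch u[i0, E + p) is a square; for δ = 1 it is x v y v z with |x v| = p and v starting at i0.
    module Alignment {i0 E p δ : ℕ} (per : PeriodicOn p i0 E) (long : i0 + (M + L) ≤ suc E)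
      (E+δ≡ : E + δ ≡ i0 + p) (δ≤1 : δ ≤ 1) (δ≤i0 : δ ≤ i0) where

      open Anchor (anchor per long) public

      i0≤Sa : i0 ≤ S a
      i0≤Sa = ≤-trans (m≤m+n i0 e1) (≤-reflexive (sym Sa))

      Sa≤E : S a ≤ E
      Sa≤E = ≤-trans (m≤m+n (S a) L) fits

      h : ℕ
      h = proj₁ (enclosingBlock E a Sa≤E)

      γ : ℕ
      γ = a + h

      Sγ≤E : S γ ≤ E
      Sγ≤E = proj₁ (proj₂ (enclosingBlock E a Sa≤E))

      E<S[1+γ] : E < S (suc γ)
      E<S[1+γ] = proj₂ (proj₂ (enclosingBlock E a Sa≤E))

      e2 : ℕ
      e2 = E ∸ S γ

      end-γ : S γ + e2 ≡ E
      end-γ = m+[n∸m]≡n Sγ≤E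

      e2<γ : e2 < blockLen γ
      e2<γ = +-cancelˡ-< (S γ) e2 (blockLen γ) (subst (S γ + e2 <_) (S-suc γ) (subst (_< S (suc γ)) (sym end-γ) E<S[1+γ]))

      matched = matching-blocks per i0≤Sa Sa′ h Sγ≤E

      gap : S a′ ≡ S γ + (e1 + e2 + δ)
      gap = begin
        S a′                    ≡⟨ Sa′ ⟩
        S a + p                 ≡⟨ cong (_+ p) Sa ⟩
        i0 + e1 + p             ≡⟨ solve 3 (λ x y z → x :+ y :+ z := y :+ (x :+ z)) refl i0 e1 p ⟩
        e1 + (i0 + p)           ≡⟨ cong (e1 +_) (sym E+δ≡) ⟩
        e1 + (E + δ)            ≡⟨ cong (λ z → e1 + (z + δ)) (sym end-γ) ⟩
        e1 + (S γ + e2 + δ)     ≡⟨ solve 4 (λ x y z w → y :+ (x :+ z :+ w) := x :+ (y :+ z :+ w)) refl (S γ) e1 e2 δ ⟩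
        S γ + (e1 + e2 + δ)     ∎
        where open ≡-Reasoning

      γ≤a′ : γ ≤ a′
      γ≤a′ = S-cancel-≤ (begin
        S γ      ≤⟨ m≤m+n (S γ) _ ⟩
        S γ + (e1 + e2 + δ) ≡⟨ sym gap ⟩
        S a′     ∎)
        where open ≤-Reasoning

      p-pos : 1 ≤ p
      p-pos = ≤-pred (+-cancelˡ-≤ i0 2 (suc p) (begin
        i0 + 2         ≤⟨ +-monoʳ-≤ i0 (≤-trans (≤-trans (f-long (t 0)) (f-short (t 0))) (m≤m+n M L)) ⟩
        i0 + (M + L)   ≤⟨ long ⟩
        suc E          ≤⟨ s≤s (≤-trans (m≤m+n E δ) (≤-reflexive E+δ≡)) ⟩
        suc (i0 + p)   ≡⟨ sym (+-suc i0 p) ⟩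
        i0 + suc p     ∎))
        where open ≤-Reasoning

      aligned : a′ ≡ γ → Outcome i0 E p δ
      aligned a′≡γ = square δ≡0 a h (period-bound a h p Sγ≡ h-pos) (h-pos , letters)
        where
        sum≡0 : e1 + e2 + δ ≡ 0
        sum≡0 = +-cancelˡ-≡ (S γ) _ 0 (trans (sym gap) (trans (cong S a′≡γ) (sym (+-identityʳ (S γ)))))
        δ≡0 : δ ≡ 0
        δ≡0 = m+n≡0⇒n≡0 (e1 + e2) sum≡0
        Sγ≡ : S (a + h) ≡ S a + p
        Sγ≡ = trans (cong S (sym a′≡γ)) Sa′
        h-pos : 1 ≤ h
        h-pos = n≢0⇒n>0 λ h≡0 → 1+n≰n (subst (1 ≤_) (+-cancelˡ-≡ (S a) p 0 (begin
          S a + p   ≡⟨ sym Sγ≡ ⟩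
          S (a + h) ≡⟨ cong (λ i → S (a + i)) h≡0 ⟩
          S (a + 0) ≡⟨ cong S (+-identityʳ a) ⟩
          S a       ≡⟨ sym (+-identityʳ (S a)) ⟩
          S a + 0   ∎)) p-pos)
          where open ≡-Reasoning
        letters : ∀ x → a ≤ x → x < a + h → t x ≡ t (x + h)
        letters x a≤x x<a+h with m≤n⇒∃[o]m+o≡n a≤x
        ... | k , refl = trans (proj₂ matched k (+-cancelˡ-< a k h x<a+h))
          (cong t (trans (cong (_+ k) a′≡γ) (xy∙z≈xz∙y a h k)))

      module ShiftedByOne (a′≡ : a′ ≡ suc γ) where

        a′≡a+1+h : a′ ≡ a + suc h
        a′≡a+1+h = trans a′≡ (sym (+-suc a h))

        β : ℕ
        β = a + suc h + h

        len-γ : e1 + e2 + δ ≡ blockLen γ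
        len-γ = +-cancelˡ-≡ (S γ) _ _ (trans (sym gap) (trans (cong S a′≡) (S-suc γ)))

        start-β : S β ≡ S γ + p
        start-β = subst (λ i → S (i + h) ≡ S γ + p) a′≡a+1+h (proj₁ matched)

        copies : ∀ k → k < h → t (a + k) ≡ t (a + suc h + k)
        copies k k<h = subst (λ i → t (a + k) ≡ t (i + k)) a′≡a+1+h (proj₂ matched k k<h)

        i0-pos-if-e1≡0 : e1 ≡ 0 → 1 ≤ i0
        i0-pos-if-e1≡0 e1≡0 = ≤-trans (n≢0⇒n>0 λ δ≡0 → <-irrefl (sym (begin
          blockLen γ     ≡⟨ sym len-γ ⟩
          e1 + e2 + δ    ≡⟨ cong₂ (λ x y → x + e2 + y) e1≡0 δ≡0 ⟩
          e2 + 0         ≡⟨ +-identityʳ e2 ⟩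
          e2             ∎)) e2<γ) δ≤i0
          where open ≡-Reasoning

        prec : Preceding i0 a e1
        prec = toPreceding before i0-pos-if-e1≡0 Sa
        open Preceding prec

        γ≈β : ∀ k → k < e2 → u (S γ + k) ≡ u (S β + k)
        γ≈β k k<e2 = trans
          (periodic-shift per (S γ) k (≤-trans i0≤Sa (S-mono-≤ (m≤m+n a h))) (subst (S γ + k <_) end-γ (+-monoʳ-< (S γ) k<e2)))
          (cong (λ i → u (i + k)) (sym start-β))

        e2<β : e2 < blockLen β
        e2<β = by-cases (e2 <? blockLen β)
          where
          by-cases : Dec (e2 < blockLen β) → e2 < blockLen β
          by-cases (yes e2<β) = e2<β
          by-cases (no  e2≮β) = ⊥-elim (<-irrefl refl (<-≤-trans e2<γ (subst (_≤ e2) (cong (λ x → length (f x)) tβ≡tγ) (≮⇒≥ e2≮β))))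
            where
            tβ≡tγ : t β ≡ t γ
            tβ≡tγ = blocks-agree⇒≡ β γ (λ k k<β _ → sym (γ≈β k (<-≤-trans k<β (≮⇒≥ e2≮β))))

        prefix : ∀ k → k < e2 → nth dB (f (t β)) k ≡ nth dB (f (t γ)) k
        prefix k k<e2 = trans (sym (u-block β k (<-trans k<e2 e2<β)))
          (trans (sym (γ≈β k k<e2)) (u-block γ k (<-trans k<e2 e2<γ)))

        suffix : ∀ k → k < e1 → nth dB (f (t a₀)) (r + k) ≡ nth dB (f (t γ)) (e2 + δ + k)
        suffix k k<e1 = begin
          nth dB (f (t a₀)) (r + k)     ≡⟨ sym (u-block a₀ (r + k) (subst (r + k <_) α-len (+-monoʳ-< r k<e1))) ⟩
          u (S a₀ + (r + k))            ≡⟨ cong u (trans (sym (+-assoc (S a₀) r k)) (cong (_+ k) α-start)) ⟩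
          u (i0 + k)                    ≡⟨ periodic-shift per i0 k ≤-refl (≤-trans (+-monoʳ-< i0 k<e1) (≤-trans (≤-reflexive (sym Sa)) Sa≤E)) ⟩
          u (i0 + p + k)                ≡⟨ cong (λ x → u (x + k)) (trans (sym E+δ≡) (cong (_+ δ) (sym end-γ))) ⟩
          u (S γ + e2 + δ + k)          ≡⟨ cong u (solve 4 (λ x y z w → x :+ y :+ z :+ w := x :+ (y :+ z :+ w)) refl (S γ) e2 δ k) ⟩
          u (S γ + (e2 + δ + k))        ≡⟨ u-block γ (e2 + δ + k) (subst (e2 + δ + k <_) (trans (solve 3 (λ x y z → (y :+ z) :+ x := x :+ y :+ z) refl e1 e2 δ) len-γ) (+-monoʳ-< (e2 + δ) k<e1)) ⟩
          nth dB (f (t γ)) (e2 + δ + k) ∎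
          where open ≡-Reasoning

      shiftedByOne : a′ ≡ suc γ → OneBlockShift i0 E p δ
      shiftedByOne a′≡ = record
        { a = a ; h = h ; e1 = e1 ; e2 = e2 ; preceding = prec ; end-γ = end-γ ; len-γ = len-γ
        ; start-β = start-β ; copies = copies ; e2<β = e2<β ; suffix = suffix ; prefix = prefix
        ; 1+h<p = period-bound a (suc h) p (trans (cong S (sym a′≡a+1+h)) Sa′) (s≤s z≤n) }
        where open ShiftedByOne a′≡

      module ShiftedByMore (b : ℕ) (a′≡ : a′ ≡ suc b) (1+γ≤b : suc γ ≤ b) where

        ℓ : ℕ
        ℓ = blockLen b

        γ+ℓ≤gap : blockLen γ + ℓ ≤ e1 + e2 + δ
        γ+ℓ≤gap = +-cancelˡ-≤ (S γ) _ _ (begin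
          S γ + (blockLen γ + ℓ)  ≡⟨ sym (+-assoc (S γ) (blockLen γ) ℓ) ⟩
          S γ + blockLen γ + ℓ    ≡⟨ cong (_+ ℓ) (sym (S-suc γ)) ⟩
          S (suc γ) + ℓ           ≤⟨ +-monoˡ-≤ ℓ (S-mono-≤ 1+γ≤b) ⟩
          S b + ℓ                 ≡⟨ sym (trans (cong S a′≡) (S-suc b)) ⟩
          S a′                    ≡⟨ gap ⟩
          S γ + (e1 + e2 + δ)     ∎)
          where open ≤-Reasoning

        1+ℓ≤e1+δ : suc ℓ ≤ e1 + δ
        1+ℓ≤e1+δ = +-cancelˡ-≤ e2 (suc ℓ) (e1 + δ) (begin
          e2 + suc ℓ        ≡⟨ +-suc e2 ℓ ⟩
          suc e2 + ℓ        ≤⟨ +-monoˡ-≤ ℓ e2<γ ⟩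
          blockLen γ + ℓ    ≤⟨ γ+ℓ≤gap ⟩
          e1 + e2 + δ       ≡⟨ solve 3 (λ x y z → x :+ y :+ z := y :+ (x :+ z)) refl e1 e2 δ ⟩
          e2 + (e1 + δ)     ∎)
          where open ≤-Reasoning

        ℓ≤e1 : ℓ ≤ e1
        ℓ≤e1 = ≤-pred (≤-trans 1+ℓ≤e1+δ (≤-trans (+-monoʳ-≤ e1 δ≤1) (≤-reflexive (+-comm e1 1))))

        prec : Preceding i0 a e1
        prec = toPreceding before (λ e1≡0 → ⊥-elim (1+n≰n (≤-trans (≤-trans (s≤s z≤n) (f-long (t b))) (subst (ℓ ≤_) e1≡0 ℓ≤e1)))) Sa
        open Preceding prec

        d : ℕ
        d = e1 ∸ ℓ

        d+ℓ≡e1 : d + ℓ ≡ e1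
        d+ℓ≡e1 = m∸n+n≡m ℓ≤e1

        r+d+ℓ≡ : r + d + ℓ ≡ blockLen a₀
        r+d+ℓ≡ = trans (+-assoc r d ℓ) (trans (cong (r +_) d+ℓ≡e1) α-len)

        i0+d+ℓ≡Sa : i0 + d + ℓ ≡ S a
        i0+d+ℓ≡Sa = trans (+-assoc i0 d ℓ) (trans (cong (i0 +_) d+ℓ≡e1) (sym Sa))

        Sb : S b ≡ i0 + d + p
        Sb = +-cancelʳ-≡ ℓ (S b) (i0 + d + p) (begin
          S b + ℓ          ≡⟨ sym (trans (cong S a′≡) (S-suc b)) ⟩
          S a′             ≡⟨ Sa′ ⟩
          S a + p          ≡⟨ cong (_+ p) (sym i0+d+ℓ≡Sa) ⟩
          i0 + d + ℓ + p   ≡⟨ xy∙z≈xz∙y (i0 + d) ℓ p ⟩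
          i0 + d + p + ℓ   ∎)
          where open ≡-Reasoning

        agree : ∀ k → k < ℓ → nth dB (f (t b)) k ≡ nth dB (f (t a₀)) (r + d + k)
        agree k k<ℓ = sym (begin
          nth dB (f (t a₀)) (r + d + k)  ≡⟨ sym (u-block a₀ (r + d + k) (subst (r + d + k <_) r+d+ℓ≡ (+-monoʳ-< (r + d) k<ℓ))) ⟩
          u (S a₀ + (r + d + k))         ≡⟨ cong u (trans (solve 4 (λ x y z w → x :+ (y :+ z :+ w) := x :+ y :+ z :+ w) refl (S a₀) r d k)
                                                          (cong (λ z → z + d + k) α-start)) ⟩
          u (i0 + d + k)                 ≡⟨ periodic-shift per (i0 + d) k (m≤m+n i0 d)
                                              (<-≤-trans (+-monoʳ-< (i0 + d) k<ℓ) (subst (_≤ E) (sym i0+d+ℓ≡Sa) Sa≤E)) ⟩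
          u (i0 + d + p + k)             ≡⟨ cong (λ z → u (z + k)) (sym Sb) ⟩
          u (S b + k)                    ≡⟨ u-block b k k<ℓ ⟩
          nth dB (f (t b)) k             ∎)
          where open ≡-Reasoning

        b-suffix : IsSuffixOf (f (t b)) (f (t a₀))
        b-suffix = pointwise⇒suffix dB (f (t b)) (f (t a₀)) (r + d) r+d+ℓ≡ agree

        ℓ<ℓ : ℓ < ℓ
        ℓ<ℓ = begin-strict
          ℓ            ≤⟨ ℓ≤e1 ⟩
          e1           <⟨ m<n+m e1 r-pos ⟩
          r + e1       ≡⟨ α-len ⟩
          blockLen a₀  ≡⟨ cong (λ x → length (f x)) (sym (suffix-code (t b) (t a₀) b-suffix)) ⟩
          ℓ            ∎
          where open ≤-Reasoning

      shiftedByMore : ∀ b → a′ ≡ suc b → suc γ ≤ b → ⊥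
      shiftedByMore b a′≡ 1+γ≤b = <-irrefl refl ℓ<ℓ
        where open ShiftedByMore b a′≡ 1+γ≤b

      outcome : Outcome i0 E p δ
      outcome = by-distance (a′ ∸ γ) (m+[n∸m]≡n γ≤a′)
        where
        by-distance : ∀ k → γ + k ≡ a′ → Outcome i0 E p δ
        by-distance zero          γ+0≡a′ = aligned (trans (sym γ+0≡a′) (+-identityʳ γ))
        by-distance (suc zero)    γ+1≡a′ = shifted (shiftedByOne (trans (sym γ+1≡a′) (+-comm γ 1)))
        by-distance (suc (suc k)) γ+k≡a′ = ⊥-elim (shiftedByMore (γ + suc k) (trans (sym γ+k≡a′) (+-suc γ (suc k)))
                                             (subst (suc γ ≤_) (sym (+-suc γ k)) (s≤s (m≤m+n γ k))))

    opaque
      desubstitute : ∀ {i0 E p δ} → PeriodicOn p i0 E → i0 + (M + L) ≤ suc E → E + δ ≡ i0 + p → δ ≤ 1 → δ ≤ i0 → Outcome i0 E p δ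
      desubstitute per long E+δ≡ δ≤1 δ≤i0 = Alignment.outcome per long E+δ≡ δ≤1 δ≤i0

    module Reduction (Forbidden : A → A → A → Set) where

      ForbiddenAt : ℕ → ℕ → Set
      ForbiddenAt j q = 1 ≤ q × Forbidden (t j) (t (j + q)) (t (j + q + q))
                      × (∀ x → suc j ≤ x → x < j + q → t x ≡ t (x + q))

      Obstruction : ℕ → ℕ → Set
      Obstruction j q = SquareAt j q ⊎ ForbiddenAt j q

      ShorterObstruction : ℕ → Set
      ShorterObstruction p = ∃ λ j → ∃ λ q → q < p × Obstruction j q

      module Resolve {i0 E p δ : ℕ} (s : OneBlockShift i0 E p δ) where
        open OneBlockShift s public
        open Preceding preceding public using (a₀; r; a≡; α-start; r-pos)

        γ β : ℕ
        γ = a + h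
        β = a + suc h + h

        fit : ShiftFit dB f δ (t a₀) (t γ) (t β) e1 e2 r
        fit = record { len-α = Preceding.α-len preceding ; r-pos = r-pos ; e2<β = e2<β ; len-γ = len-γ
                     ; suffix = suffix ; prefix = prefix }

        a₀+q≡γ : a₀ + suc h ≡ γ
        a₀+q≡γ = trans (+-suc a₀ h) (cong (_+ h) (sym a≡))

        γ+q≡β : γ + suc h ≡ β
        γ+q≡β = xy∙z≈xz∙y a h (suc h)

        copy : ∀ k → k < h → t (a + k) ≡ t (a + k + suc h)
        copy k k<h = trans (copies k k<h) (cong t (xy∙z≈xz∙y a (suc h) k))

        copy-after-α : ∀ x → suc a₀ ≤ x → x < a₀ + suc h → t x ≡ t (x + suc h)
        copy-after-α x a₀<x x<a₀+q with m≤n⇒∃[o]m+o≡n (subst (_≤ x) (sym a≡) a₀<x)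
        ... | k , refl = copy k (+-cancelˡ-< a k h (subst (a + k <_) a₀+q≡γ x<a₀+q))

        resolve : t a₀ ≡ t γ ⊎ t β ≡ t γ ⊎ Forbidden (t a₀) (t γ) (t β) → ShorterObstruction p
        resolve (inj₁ α≡γ) = a₀ , suc h , 1+h<p , inj₁ (s≤s z≤n , periodic)
          where
          periodic : ∀ x → a₀ ≤ x → x < a₀ + suc h → t x ≡ t (x + suc h)
          periodic x a₀≤x x<a₀+q with m≤n⇒m<n∨m≡n a₀≤x
          ... | inj₁ a₀<x = copy-after-α x a₀<x x<a₀+q
          ... | inj₂ refl = trans α≡γ (cong t (sym a₀+q≡γ))
        resolve (inj₂ (inj₁ β≡γ)) = a , suc h , 1+h<p , inj₁ (s≤s z≤n , periodic)
          where
          periodic : ∀ x → a ≤ x → x < a + suc h → t x ≡ t (x + suc h)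
          periodic x a≤x x<a+q with m≤n⇒∃[o]m+o≡n a≤x
          ... | k , refl with m≤n⇒m<n∨m≡n (≤-pred (+-cancelˡ-< a k (suc h) x<a+q))
          ...   | inj₁ k<h  = copy k k<h
          ...   | inj₂ refl = trans (sym β≡γ) (cong t (sym γ+q≡β))
        resolve (inj₂ (inj₂ forbidden)) = a₀ , suc h , 1+h<p , inj₂ (s≤s z≤n , forbidden′ , copy-after-α)
          where
          forbidden′ : Forbidden (t a₀) (t (a₀ + suc h)) (t (a₀ + suc h + suc h))
          forbidden′ = subst₂ (Forbidden (t a₀)) (cong t (sym a₀+q≡γ))
            (cong t (trans (sym γ+q≡β) (cong (_+ suc h) (sym a₀+q≡γ)))) forbidden

      SquareShiftsResolved : Set
      SquareShiftsResolved = ∀ {α γ β e1 e2 r} → ShiftFit dB f 0 α γ β e1 e2 r → α ≡ γ ⊎ β ≡ γ ⊎ Forbidden α γ β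

      -- Forbiddenᵤ is imposed on the letters of u at i, i + p and i + 2p, which lie in f(α), f(γ) and f(β).
      ForbiddenShiftsResolved : (B → B → B → Set) → Set
      ForbiddenShiftsResolved Forbiddenᵤ = ∀ {α γ β e1 e2 r} → ShiftFit dB f 1 α γ β e1 e2 r →
        Forbiddenᵤ (nth dB (f α) (pred r)) (nth dB (f γ) e2) (nth dB (f β) e2) → α ≡ γ ⊎ β ≡ γ ⊎ Forbidden α γ β

      long-square⇒shorter : SquareShiftsResolved → ∀ i p → M + L ≤ p → PeriodicOn p i (i + p) → ShorterObstruction p
      long-square⇒shorter resolved i p long per
        with desubstitute per (≤-trans (+-monoʳ-≤ i long) (n≤1+n (i + p))) (+-identityʳ (i + p)) z≤n z≤n
      ... | square _ a h h<p sq = a , h , h<p , inj₁ sq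
      ... | shifted s = Resolve.resolve s (resolved (Resolve.fit s))

      long-forbidden⇒shorter : ∀ Forbiddenᵤ → ForbiddenShiftsResolved Forbiddenᵤ → ∀ i p → M + L ≤ p →
        Forbiddenᵤ (u i) (u (i + p)) (u (i + p + p)) → PeriodicOn p (suc i) (i + p) → ShorterObstruction p
      long-forbidden⇒shorter Forbiddenᵤ resolved i p long forbidden per
        with desubstitute per (s≤s (+-monoʳ-≤ i long)) (+-comm (i + p) 1) ≤-refl (s≤s z≤n)
      ... | square () _ _ _ _
      ... | shifted s = resolve (resolved fit letters)
        where
        open Resolve s
        1+[r-1]≡r : suc (pred r) ≡ r
        1+[r-1]≡r = suc-pred r {{>-nonZero r-pos}}
        u-i : u i ≡ nth dB (f (t a₀)) (pred r)
        u-i = trans (cong u (suc-injective (trans (sym α-start) (trans (cong (S a₀ +_) (sym 1+[r-1]≡r)) (+-suc (S a₀) (pred r))))))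
          (u-block a₀ (pred r) (subst (_≤ blockLen a₀) (sym 1+[r-1]≡r) (subst (r ≤_) (ShiftFit.len-α fit) (m≤m+n r e1))))
        e2<γ : e2 < blockLen γ
        e2<γ = subst (e2 <_) len-γ (m+n≤o⇒n≤o e1 (≤-reflexive (trans (+-suc e1 e2) (sym (+-comm (e1 + e2) 1)))))
        u-i+p : u (i + p) ≡ nth dB (f (t γ)) e2
        u-i+p = trans (cong u (sym end-γ)) (u-block γ e2 e2<γ)
        u-i+2p : u (i + p + p) ≡ nth dB (f (t β)) e2
        u-i+2p = trans (cong u (trans (cong (_+ p) (sym end-γ)) (trans (xy∙z≈xz∙y (S γ) e2 p) (cong (_+ e2) (sym start-β)))))
          (u-block β e2 e2<β)
        letters : Forbiddenᵤ (nth dB (f (t a₀)) (pred r)) (nth dB (f (t γ)) e2) (nth dB (f (t β)) e2)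
        letters = subst₂ (Forbiddenᵤ _) u-i+p u-i+2p (subst (λ x → Forbiddenᵤ x (u (i + p)) (u (i + p + p))) u-i forbidden)

module MorphismChecks {A B : Set} {{_ : BoolEq A}} {{_ : BoolEq B}} (dB : B) (f : A → List B)
  (everyA : (A → Bool) → Bool) (everyA-sound : ∀ P → everyA P ≡ true → ∀ x → P x ≡ true)
  (forbidden : A → A → A → Bool)
  where

  resolvedᵇ : A → A → A → Bool
  resolvedᵇ α γ β = α == γ ∨ (β == γ ∨ forbidden α γ β)

  resolvedᵇ-sound : ∀ α γ β → resolvedᵇ α γ β ≡ true → α ≡ γ ⊎ β ≡ γ ⊎ forbidden α γ β ≡ true
  resolvedᵇ-sound α γ β res with α == γ in α≟γ
  ... | true = inj₁ (==-sound α γ α≟γ)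
  ... | false with β == γ in β≟γ
  ...   | true  = inj₂ (inj₁ (==-sound β γ β≟γ))
  ...   | false = inj₂ (inj₂ res)

  fitsWithᵇ : ℕ → A → A → A → ℕ → ℕ → ℕ → Bool
  fitsWithᵇ δ α γ β e1 e2 r = (e1 <ᵇ length (f α)) ∧ ((e2 <ᵇ length (f β)) ∧ ((e1 + e2 + δ ≡ᵇ length (f γ)) ∧
     ((drop r (f α) == drop (e2 + δ) (f γ)) ∧ (take e2 (f β) == take e2 (f γ)))))

  fitsᵇ : ℕ → A → A → A → ℕ → Bool
  fitsᵇ δ α γ β e1 = fitsWithᵇ δ α γ β e1 (length (f γ) ∸ e1 ∸ δ) (length (f α) ∸ e1)

  fitsᵇ-complete : ∀ {δ α γ β e1 e2 r} → ShiftFit dB f δ α γ β e1 e2 r → fitsᵇ δ α γ β e1 ≡ true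
  fitsᵇ-complete {δ} {α} {γ} {β} {e1} {e2} {r} fit =
    subst₂ (λ x y → fitsWithᵇ δ α γ β e1 x y ≡ true) e2≡ r≡
      (∧-intro (≡true (<⇒<ᵇ e1<α)) (∧-intro (≡true (<⇒<ᵇ e2<β)) (∧-intro (≡true (≡⇒≡ᵇ _ _ len-γ))
        (∧-intro (==-complete drop≡) (==-complete take≡)))))
    where
    open ShiftFit fit
    ≡true : ∀ {x} → T x → x ≡ true
    ≡true = Equivalence.to T-≡
    e1<α : e1 < length (f α)
    e1<α = subst (e1 <_) len-α (m<n+m e1 r-pos)
    length-drop-α : length (drop r (f α)) ≡ e1
    length-drop-α = trans (length-drop r (f α)) (trans (cong (_∸ r) (sym len-α)) (m+n∸m≡n r e1))
    length-drop-γ : length (drop (e2 + δ) (f γ)) ≡ e1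
    length-drop-γ = trans (length-drop (e2 + δ) (f γ)) (trans (cong (_∸ (e2 + δ)) (sym len-γ))
      (trans (cong (_∸ (e2 + δ)) (trans (+-assoc e1 e2 δ) (+-comm e1 (e2 + δ)))) (m+n∸m≡n (e2 + δ) e1)))
    drop≡ : drop r (f α) ≡ drop (e2 + δ) (f γ)
    drop≡ = pointwise⇒≡ dB _ _ (trans length-drop-α (sym length-drop-γ))
      (λ k k<e1 → trans (nth-drop dB (f α) r k) (trans (suffix k (subst (k <_) length-drop-α k<e1)) (sym (nth-drop dB (f γ) (e2 + δ) k))))
    e2≤γ : e2 ≤ length (f γ)
    e2≤γ = subst (e2 ≤_) len-γ (≤-trans (m≤n+m e2 e1) (m≤m+n (e1 + e2) δ))
    length-take-β : length (take e2 (f β)) ≡ e2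
    length-take-β = length-take-≤ e2 (f β) (<⇒≤ e2<β)
    take≡ : take e2 (f β) ≡ take e2 (f γ)
    take≡ = pointwise⇒≡ dB _ _ (trans length-take-β (sym (length-take-≤ e2 (f γ) e2≤γ)))
      (λ k k<n → let k<e2 = subst (k <_) length-take-β k<n in
        trans (nth-take dB (f β) e2 k k<e2) (trans (prefix k k<e2) (sym (nth-take dB (f γ) e2 k k<e2))))

  e1≤γ : ∀ {δ α γ β e1 e2 r} → ShiftFit dB f δ α γ β e1 e2 r → e1 < suc (length (f γ))
  e1≤γ {δ} {e1 = e1} {e2} fit = s≤s (subst (e1 ≤_) (ShiftFit.len-γ fit) (≤-trans (m≤m+n e1 e2) (m≤m+n (e1 + e2) δ)))

  everyShift : (A → A → A → ℕ → Bool) → Bool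
  everyShift P = everyA λ α → everyA λ γ → everyA λ β → allBelow (suc (length (f γ))) (P α γ β)

  everyShift-sound : ∀ P → everyShift P ≡ true → ∀ α γ β e1 → e1 < suc (length (f γ)) → P α γ β e1 ≡ true
  everyShift-sound P all α γ β = allBelow-sound _ _ (everyA-sound _ (everyA-sound _ (everyA-sound _ all α) γ) β)

  squareShiftsResolvedᵇ : Bool
  squareShiftsResolvedᵇ = everyShift λ α γ β e1 → not (fitsᵇ 0 α γ β e1) ∨ resolvedᵇ α γ β

  squareShiftsResolved : squareShiftsResolvedᵇ ≡ true → ∀ {α γ β e1 e2 r} → ShiftFit dB f 0 α γ β e1 e2 r →
    α ≡ γ ⊎ β ≡ γ ⊎ forbidden α γ β ≡ true
  squareShiftsResolved all {α} {γ} {β} {e1} fit = resolvedᵇ-sound α γ β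
    (¬∨-modusPonens (everyShift-sound _ all α γ β e1 (e1≤γ fit)) (fitsᵇ-complete fit))

  module _ (forbiddenᵤ : B → B → B → Bool) where

    forbiddenLettersᵇ : A → A → A → ℕ → Bool
    forbiddenLettersᵇ α γ β e1 =
      forbiddenᵤ (nth dB (f α) (pred (length (f α) ∸ e1))) (nth dB (f γ) (length (f γ) ∸ e1 ∸ 1)) (nth dB (f β) (length (f γ) ∸ e1 ∸ 1))

    forbiddenShiftsResolvedᵇ : Bool
    forbiddenShiftsResolvedᵇ = everyShift λ α γ β e1 → not (fitsᵇ 1 α γ β e1 ∧ forbiddenLettersᵇ α γ β e1) ∨ resolvedᵇ α γ β

    forbiddenShiftsResolved : forbiddenShiftsResolvedᵇ ≡ true → ∀ {α γ β e1 e2 r} → ShiftFit dB f 1 α γ β e1 e2 r →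
      forbiddenᵤ (nth dB (f α) (pred r)) (nth dB (f γ) e2) (nth dB (f β) e2) ≡ true →
      α ≡ γ ⊎ β ≡ γ ⊎ forbidden α γ β ≡ true
    forbiddenShiftsResolved all {α} {γ} {β} {e1} {e2} {r} fit letters = resolvedᵇ-sound α γ β
      (¬∨-modusPonens (everyShift-sound _ all α γ β e1 (e1≤γ fit))
        (∧-intro (fitsᵇ-complete fit) (subst₂ (λ x y → forbiddenᵤ (nth dB (f α) (pred x)) (nth dB (f γ) y) (nth dB (f β) y) ≡ true)
          (ShiftFit.r≡ fit) (ShiftFit.e2≡ fit) letters)))

  prefixCodeᵇ : Bool
  prefixCodeᵇ = everyA λ x → everyA λ y → not (take (length (f x)) (f y) == f x) ∨ (x == y)

  prefixCode : prefixCodeᵇ ≡ true → ∀ x y → IsPrefixOf (f x) (f y) → x ≡ y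
  prefixCode ok x y (zs , fx++zs≡fy) = ==-sound x y (¬∨-modusPonens (everyA-sound _ (everyA-sound _ ok x) y)
    (==-complete (trans (cong (take (length (f x))) (sym fx++zs≡fy)) (take-++-length (f x) zs))))

  suffixCodeᵇ : Bool
  suffixCodeᵇ = everyA λ x → everyA λ y → not (drop (length (f y) ∸ length (f x)) (f y) == f x) ∨ (x == y)

  suffixCode : suffixCodeᵇ ≡ true → ∀ x y → IsSuffixOf (f x) (f y) → x ≡ y
  suffixCode ok x y suffix = ==-sound x y (¬∨-modusPonens (everyA-sound _ (everyA-sound _ ok x) y)
    (==-complete (suffix⇒drop suffix)))

-- The fixed point t = φ^ω(a) and the binary word w = ψ(t)

data Letter : Set where
  a b c d : Letter

instance
  BoolEq-Letter : BoolEq Letter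
  BoolEq-Letter = record { _==_ = _==ₗ_ ; ==-sound = sound ; ==-refl = refl′ }
    where
    _==ₗ_ : Letter → Letter → Bool
    a ==ₗ a = true
    b ==ₗ b = true
    c ==ₗ c = true
    d ==ₗ d = true
    _ ==ₗ _ = false
    sound : ∀ x y → x ==ₗ y ≡ true → x ≡ y
    sound a a _ = refl
    sound b b _ = refl
    sound c c _ = refl
    sound d d _ = refl
    refl′ : ∀ x → x ==ₗ x ≡ true
    refl′ a = refl
    refl′ b = refl
    refl′ c = refl
    refl′ d = refl

everyLetter : (Letter → Bool) → Bool
everyLetter P = P a ∧ (P b ∧ (P c ∧ P d))

everyLetter-sound : ∀ P → everyLetter P ≡ true → ∀ x → P x ≡ true
everyLetter-sound P all a = ∧-elimˡ all
everyLetter-sound P all b = ∧-elimˡ (∧-elimʳ {P a} all)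
everyLetter-sound P all c = ∧-elimˡ (∧-elimʳ {P b} (∧-elimʳ {P a} all))
everyLetter-sound P all d = ∧-elimʳ {P c} (∧-elimʳ {P b} (∧-elimʳ {P a} all))

φ : Letter → List Letter
φ a = a ∷ d ∷ a ∷ []
φ b = b ∷ c ∷ b ∷ []
φ c = a ∷ d ∷ c ∷ d ∷ a ∷ []
φ d = b ∷ c ∷ d ∷ c ∷ b ∷ []

pattern O = false
pattern I = true

ψ : Letter → List Bool
ψ a = I ∷ O ∷ O ∷ I ∷ I ∷ I ∷ O ∷ I ∷ I ∷ O ∷ O ∷ I ∷ I ∷ I ∷ O ∷ O ∷ O ∷ I ∷ O ∷ O ∷ I ∷ I ∷ I ∷ []
ψ b = O ∷ I ∷ I ∷ O ∷ O ∷ O ∷ I ∷ O ∷ O ∷ I ∷ I ∷ O ∷ O ∷ O ∷ I ∷ I ∷ I ∷ O ∷ I ∷ I ∷ O ∷ O ∷ O ∷ []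
ψ c = I ∷ O ∷ O ∷ I ∷ I ∷ I ∷ O ∷ I ∷ I ∷ O ∷ O ∷ I ∷ I ∷ I ∷ O ∷ O ∷ O ∷ I ∷ O ∷ O ∷ I ∷ I ∷ O ∷ O ∷ O ∷ I ∷ I ∷ I ∷ O ∷ I ∷ I ∷ O ∷ O ∷ I ∷ I ∷ I ∷ O ∷ O ∷ O ∷ I ∷ O ∷ O ∷ I ∷ I ∷ I ∷ []
ψ d = O ∷ I ∷ I ∷ O ∷ O ∷ O ∷ I ∷ O ∷ O ∷ I ∷ I ∷ O ∷ O ∷ O ∷ I ∷ I ∷ I ∷ O ∷ I ∷ I ∷ O ∷ O ∷ I ∷ I ∷ I ∷ O ∷ O ∷ O ∷ I ∷ O ∷ O ∷ I ∷ I ∷ O ∷ O ∷ O ∷ I ∷ I ∷ I ∷ O ∷ I ∷ I ∷ O ∷ O ∷ O ∷ []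

forbiddenᵇ : Letter → Letter → Letter → Bool
forbiddenᵇ c a c = true
forbiddenᵇ d b d = true
forbiddenᵇ _ _ _ = false

Forbidden : Letter → Letter → Letter → Set
Forbidden x y z = forbiddenᵇ x y z ≡ true

φ-≥2 : ∀ x → 2 ≤ length (φ x)
φ-≥2 a = ≤ᵇ⇒≤ 2 3 _
φ-≥2 b = ≤ᵇ⇒≤ 2 3 _
φ-≥2 c = ≤ᵇ⇒≤ 2 5 _
φ-≥2 d = ≤ᵇ⇒≤ 2 5 _

φ-≤5 : ∀ x → length (φ x) ≤ 5
φ-≤5 a = ≤ᵇ⇒≤ 3 5 _
φ-≤5 b = ≤ᵇ⇒≤ 3 5 _
φ-≤5 c = ≤-refl
φ-≤5 d = ≤-refl

ψ-≥23 : ∀ x → 23 ≤ length (ψ x)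
ψ-≥23 a = ≤-refl
ψ-≥23 b = ≤-refl
ψ-≥23 c = ≤ᵇ⇒≤ 23 45 _
ψ-≥23 d = ≤ᵇ⇒≤ 23 45 _

ψ-≤45 : ∀ x → length (ψ x) ≤ 45
ψ-≤45 a = ≤ᵇ⇒≤ 23 45 _
ψ-≤45 b = ≤ᵇ⇒≤ 23 45 _
ψ-≤45 c = ≤-refl
ψ-≤45 d = ≤-refl

ψ-≥2 : ∀ x → 2 ≤ length (ψ x)
ψ-≥2 x = ≤-trans (≤ᵇ⇒≤ 2 23 _) (ψ-≥23 x)

φⁿ[a] : ℕ → List Letter
φⁿ[a] zero    = a ∷ []
φⁿ[a] (suc n) = concatMap φ (φⁿ[a] n)

φⁿ[a]-prefix : ∀ n → IsPrefixOf (φⁿ[a] n) (φⁿ[a] (suc n))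
φⁿ[a]-prefix zero    = d ∷ a ∷ [] , refl
φⁿ[a]-prefix (suc n) = concatMap-prefix φ (φⁿ[a]-prefix n)

φⁿ[a]-long : ∀ n → n < length (φⁿ[a] n)
φⁿ[a]-long zero    = s≤s z≤n
φⁿ[a]-long (suc n) = begin-strict
  suc n                     <⟨ s≤s (m≤n+m (suc n) n) ⟩
  suc n + suc n             ≤⟨ +-mono-≤ (φⁿ[a]-long n) (φⁿ[a]-long n) ⟩
  ℓ + ℓ                     ≡⟨ cong (ℓ +_) (sym (+-identityʳ ℓ)) ⟩
  2 * ℓ                     ≡⟨ *-comm 2 ℓ ⟩
  ℓ * 2                     ≤⟨ length-concatMap-≥ φ 2 φ-≥2 (φⁿ[a] n) ⟩
  length (φⁿ[a] (suc n))    ∎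
  where
  open ≤-Reasoning
  ℓ = length (φⁿ[a] n)

module φ^ω[a] = PrefixLimit a φⁿ[a] φⁿ[a]-prefix φⁿ[a]-long

t : ℕ → Letter
t = φ^ω[a].limit

module Φt = MorphicImage a φⁿ[a] φⁿ[a]-prefix φⁿ[a]-long a φ (λ x → ≤-trans (s≤s z≤n) (φ-≥2 x))

φ[t]≡t : ∀ y → Φt.Image.limit y ≡ t y
φ[t]≡t y = sym (φ^ω[a].limit-nth (suc (suc y)) y (<-trans (n<1+n y) (<-trans (n<1+n (suc y)) (φⁿ[a]-long (suc (suc y))))))

t-block : ∀ j r → r < length (φ (t j)) → t (Φt.blockStart j + r) ≡ nth a (φ (t j)) r
t-block j r r<ℓ = trans (sym (φ[t]≡t (Φt.blockStart j + r))) (Φt.image-block j r r<ℓ)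

module Ψt = MorphicImage a φⁿ[a] φⁿ[a]-prefix φⁿ[a]-long false ψ (λ x → ≤-trans (s≤s z≤n) (ψ-≥2 x))

w : InfWord
w = Ψt.Image.limit

module TBlocks = Blocks a φ t t Φt.blockStart refl Φt.blockStart-suc t-block φ-≥2
module WBlocks = Blocks false ψ t w Ψt.blockStart refl Ψt.blockStart-suc Ψt.image-block ψ-≥2
module Φchecks = MorphismChecks a φ everyLetter everyLetter-sound forbiddenᵇ
module Ψchecks = MorphismChecks false ψ everyLetter everyLetter-sound forbiddenᵇ

factors₇ : List (List Letter)
factors₇ =
  (a ∷ b ∷ c ∷ b ∷ a ∷ d ∷ a ∷ []) ∷ (a ∷ b ∷ c ∷ b ∷ a ∷ d ∷ c ∷ []) ∷
  (a ∷ b ∷ c ∷ d ∷ c ∷ b ∷ a ∷ []) ∷ (a ∷ d ∷ a ∷ b ∷ c ∷ b ∷ a ∷ []) ∷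
  (a ∷ d ∷ a ∷ b ∷ c ∷ d ∷ c ∷ []) ∷ (a ∷ d ∷ c ∷ d ∷ a ∷ b ∷ c ∷ []) ∷
  (b ∷ a ∷ d ∷ a ∷ b ∷ c ∷ b ∷ []) ∷ (b ∷ a ∷ d ∷ a ∷ b ∷ c ∷ d ∷ []) ∷
  (b ∷ a ∷ d ∷ c ∷ d ∷ a ∷ b ∷ []) ∷ (b ∷ c ∷ b ∷ a ∷ d ∷ a ∷ b ∷ []) ∷
  (b ∷ c ∷ b ∷ a ∷ d ∷ c ∷ d ∷ []) ∷ (b ∷ c ∷ d ∷ c ∷ b ∷ a ∷ d ∷ []) ∷
  (c ∷ b ∷ a ∷ d ∷ a ∷ b ∷ c ∷ []) ∷ (c ∷ b ∷ a ∷ d ∷ c ∷ d ∷ a ∷ []) ∷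
  (c ∷ d ∷ a ∷ b ∷ c ∷ b ∷ a ∷ []) ∷ (c ∷ d ∷ a ∷ b ∷ c ∷ d ∷ c ∷ []) ∷
  (c ∷ d ∷ c ∷ b ∷ a ∷ d ∷ a ∷ []) ∷ (c ∷ d ∷ c ∷ b ∷ a ∷ d ∷ c ∷ []) ∷
  (d ∷ a ∷ b ∷ c ∷ b ∷ a ∷ d ∷ []) ∷ (d ∷ a ∷ b ∷ c ∷ d ∷ c ∷ b ∷ []) ∷
  (d ∷ c ∷ b ∷ a ∷ d ∷ a ∷ b ∷ []) ∷ (d ∷ c ∷ b ∷ a ∷ d ∷ c ∷ d ∷ []) ∷
  (d ∷ c ∷ d ∷ a ∷ b ∷ c ∷ b ∷ []) ∷ (d ∷ c ∷ d ∷ a ∷ b ∷ c ∷ d ∷ []) ∷ []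

factors₁₃ : List (List Letter)
factors₁₃ =
  (a ∷ b ∷ c ∷ b ∷ a ∷ d ∷ a ∷ b ∷ c ∷ d ∷ c ∷ b ∷ a ∷ []) ∷ (a ∷ b ∷ c ∷ b ∷ a ∷ d ∷ c ∷ d ∷ a ∷ b ∷ c ∷ b ∷ a ∷ []) ∷
  (a ∷ b ∷ c ∷ b ∷ a ∷ d ∷ c ∷ d ∷ a ∷ b ∷ c ∷ d ∷ c ∷ []) ∷ (a ∷ b ∷ c ∷ d ∷ c ∷ b ∷ a ∷ d ∷ a ∷ b ∷ c ∷ b ∷ a ∷ []) ∷
  (a ∷ b ∷ c ∷ d ∷ c ∷ b ∷ a ∷ d ∷ c ∷ d ∷ a ∷ b ∷ c ∷ []) ∷ (a ∷ d ∷ a ∷ b ∷ c ∷ b ∷ a ∷ d ∷ c ∷ d ∷ a ∷ b ∷ c ∷ []) ∷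
  (a ∷ d ∷ a ∷ b ∷ c ∷ d ∷ c ∷ b ∷ a ∷ d ∷ a ∷ b ∷ c ∷ []) ∷ (a ∷ d ∷ a ∷ b ∷ c ∷ d ∷ c ∷ b ∷ a ∷ d ∷ c ∷ d ∷ a ∷ []) ∷
  (a ∷ d ∷ c ∷ d ∷ a ∷ b ∷ c ∷ b ∷ a ∷ d ∷ a ∷ b ∷ c ∷ []) ∷ (a ∷ d ∷ c ∷ d ∷ a ∷ b ∷ c ∷ d ∷ c ∷ b ∷ a ∷ d ∷ a ∷ []) ∷
  (a ∷ d ∷ c ∷ d ∷ a ∷ b ∷ c ∷ d ∷ c ∷ b ∷ a ∷ d ∷ c ∷ []) ∷ (b ∷ a ∷ d ∷ a ∷ b ∷ c ∷ b ∷ a ∷ d ∷ c ∷ d ∷ a ∷ b ∷ []) ∷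
  (b ∷ a ∷ d ∷ a ∷ b ∷ c ∷ d ∷ c ∷ b ∷ a ∷ d ∷ a ∷ b ∷ []) ∷ (b ∷ a ∷ d ∷ a ∷ b ∷ c ∷ d ∷ c ∷ b ∷ a ∷ d ∷ c ∷ d ∷ []) ∷
  (b ∷ a ∷ d ∷ c ∷ d ∷ a ∷ b ∷ c ∷ b ∷ a ∷ d ∷ a ∷ b ∷ []) ∷ (b ∷ a ∷ d ∷ c ∷ d ∷ a ∷ b ∷ c ∷ d ∷ c ∷ b ∷ a ∷ d ∷ []) ∷
  (b ∷ c ∷ b ∷ a ∷ d ∷ a ∷ b ∷ c ∷ d ∷ c ∷ b ∷ a ∷ d ∷ []) ∷ (b ∷ c ∷ b ∷ a ∷ d ∷ c ∷ d ∷ a ∷ b ∷ c ∷ b ∷ a ∷ d ∷ []) ∷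
  (b ∷ c ∷ b ∷ a ∷ d ∷ c ∷ d ∷ a ∷ b ∷ c ∷ d ∷ c ∷ b ∷ []) ∷ (b ∷ c ∷ d ∷ c ∷ b ∷ a ∷ d ∷ a ∷ b ∷ c ∷ b ∷ a ∷ d ∷ []) ∷
  (b ∷ c ∷ d ∷ c ∷ b ∷ a ∷ d ∷ c ∷ d ∷ a ∷ b ∷ c ∷ b ∷ []) ∷ (b ∷ c ∷ d ∷ c ∷ b ∷ a ∷ d ∷ c ∷ d ∷ a ∷ b ∷ c ∷ d ∷ []) ∷
  (c ∷ b ∷ a ∷ d ∷ a ∷ b ∷ c ∷ b ∷ a ∷ d ∷ c ∷ d ∷ a ∷ []) ∷ (c ∷ b ∷ a ∷ d ∷ a ∷ b ∷ c ∷ d ∷ c ∷ b ∷ a ∷ d ∷ a ∷ []) ∷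
  (c ∷ b ∷ a ∷ d ∷ a ∷ b ∷ c ∷ d ∷ c ∷ b ∷ a ∷ d ∷ c ∷ []) ∷ (c ∷ b ∷ a ∷ d ∷ c ∷ d ∷ a ∷ b ∷ c ∷ b ∷ a ∷ d ∷ a ∷ []) ∷
  (c ∷ b ∷ a ∷ d ∷ c ∷ d ∷ a ∷ b ∷ c ∷ d ∷ c ∷ b ∷ a ∷ []) ∷ (c ∷ d ∷ a ∷ b ∷ c ∷ b ∷ a ∷ d ∷ a ∷ b ∷ c ∷ d ∷ c ∷ []) ∷
  (c ∷ d ∷ a ∷ b ∷ c ∷ d ∷ c ∷ b ∷ a ∷ d ∷ a ∷ b ∷ c ∷ []) ∷ (c ∷ d ∷ a ∷ b ∷ c ∷ d ∷ c ∷ b ∷ a ∷ d ∷ c ∷ d ∷ a ∷ []) ∷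
  (c ∷ d ∷ c ∷ b ∷ a ∷ d ∷ a ∷ b ∷ c ∷ b ∷ a ∷ d ∷ c ∷ []) ∷ (c ∷ d ∷ c ∷ b ∷ a ∷ d ∷ c ∷ d ∷ a ∷ b ∷ c ∷ b ∷ a ∷ []) ∷
  (c ∷ d ∷ c ∷ b ∷ a ∷ d ∷ c ∷ d ∷ a ∷ b ∷ c ∷ d ∷ c ∷ []) ∷ (d ∷ a ∷ b ∷ c ∷ b ∷ a ∷ d ∷ a ∷ b ∷ c ∷ d ∷ c ∷ b ∷ []) ∷
  (d ∷ a ∷ b ∷ c ∷ b ∷ a ∷ d ∷ c ∷ d ∷ a ∷ b ∷ c ∷ b ∷ []) ∷ (d ∷ a ∷ b ∷ c ∷ b ∷ a ∷ d ∷ c ∷ d ∷ a ∷ b ∷ c ∷ d ∷ []) ∷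
  (d ∷ a ∷ b ∷ c ∷ d ∷ c ∷ b ∷ a ∷ d ∷ a ∷ b ∷ c ∷ b ∷ []) ∷ (d ∷ a ∷ b ∷ c ∷ d ∷ c ∷ b ∷ a ∷ d ∷ c ∷ d ∷ a ∷ b ∷ []) ∷
  (d ∷ c ∷ b ∷ a ∷ d ∷ a ∷ b ∷ c ∷ b ∷ a ∷ d ∷ c ∷ d ∷ []) ∷ (d ∷ c ∷ b ∷ a ∷ d ∷ c ∷ d ∷ a ∷ b ∷ c ∷ b ∷ a ∷ d ∷ []) ∷
  (d ∷ c ∷ b ∷ a ∷ d ∷ c ∷ d ∷ a ∷ b ∷ c ∷ d ∷ c ∷ b ∷ []) ∷ (d ∷ c ∷ d ∷ a ∷ b ∷ c ∷ b ∷ a ∷ d ∷ a ∷ b ∷ c ∷ d ∷ []) ∷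
  (d ∷ c ∷ d ∷ a ∷ b ∷ c ∷ d ∷ c ∷ b ∷ a ∷ d ∷ a ∷ b ∷ []) ∷ (d ∷ c ∷ d ∷ a ∷ b ∷ c ∷ d ∷ c ∷ b ∷ a ∷ d ∷ c ∷ d ∷ []) ∷ []

module TWindows₁₃ = TBlocks.Windows a 12 factors₁₃ 13 2 φ-≥2 (≤ᵇ⇒≤ 13 24 _)

factors₁₃-closed : TWindows₁₃.windowsᵇ (λ _ v → v ∈ᵇ factors₁₃) ≡ true
factors₁₃-closed = refl

factor₁₃ : ∀ j → segment t j 13 ∈ᵇ factors₁₃ ≡ true
factor₁₃ = <-rec (λ j → segment t j 13 ∈ᵇ factors₁₃ ≡ true) step
  where
  step : ∀ j → (∀ {i} → i < j → segment t i 13 ∈ᵇ factors₁₃ ≡ true) → segment t j 13 ∈ᵇ factors₁₃ ≡ true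
  step zero    _ = subst (λ v → v ∈ᵇ factors₁₃ ≡ true) (φ^ω[a].take≡segment 3 13 (≤ᵇ⇒≤ 13 (length (φⁿ[a] 3)) _)) refl
  step (suc x) earlier = from-block (TBlocks.locate (suc x))
    where
    from-block : (∃ λ j → ∃ λ r → r < length (φ (t j)) × Φt.blockStart j + r ≡ suc x) → segment t (suc x) 13 ∈ᵇ factors₁₃ ≡ true
    from-block (j , r , r<ℓ , e) = subst (λ y → segment t y 13 ∈ᵇ factors₁₃ ≡ true) e
      (TWindows₁₃.window-in-block (λ _ v → v ∈ᵇ factors₁₃) factors₁₃-closed j r r<ℓ (earlier (TBlocks.index<position j r x e)))

factors₇-cover : all (λ v → take 7 v ∈ᵇ factors₇) factors₁₃ ≡ true
factors₇-cover = refl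

factor₇ : ∀ j → segment t j 7 ∈ᵇ factors₇ ≡ true
factor₇ j = subst (λ v → v ∈ᵇ factors₇ ≡ true) (take-segment t j 7 13 (≤ᵇ⇒≤ 7 13 _))
  (all-∈ᵇ (λ v → take 7 v ∈ᵇ factors₇) factors₁₃ factors₇-cover (segment t j 13) (factor₁₃ j))

-- Obstructions in t

module TWindows₂ = TBlocks.Windows a 12 factors₁₃ 2 2 φ-≥2 (≤ᵇ⇒≤ 2 24 _)

t-synchronizing : ∀ y z → (∀ r → r < 2 → t (y + r) ≡ t (z + r)) → TBlocks.IsBlockStart y → TBlocks.IsBlockStart z
t-synchronizing = TWindows₂.synchronizing-from factor₁₃ (_∈ᵇ ((a ∷ d ∷ []) ∷ (b ∷ c ∷ []) ∷ [])) refl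

module TDesubstitution = TBlocks.Desubstitution 5 φ-≤5 2 t-synchronizing (Φchecks.prefixCode refl) (Φchecks.suffixCode refl)
open TDesubstitution.Reduction Forbidden

squareAtStartᵇ : ℕ → List Letter → Bool
squareAtStartᵇ q v = take q v == take q (drop q v)

forbiddenAtStartᵇ : ℕ → List Letter → Bool
forbiddenAtStartᵇ q v = forbiddenᵇ (nth a v 0) (nth a v q) (nth a v (q + q))
                      ∧ (take (pred q) (drop 1 v) == take (pred q) (drop (suc q) v))

noShortObstructionᵇ : List Letter → ℕ → Bool
noShortObstructionᵇ v q = (q ≡ᵇ 0) ∨ (not (squareAtStartᵇ q v) ∧ not (forbiddenAtStartᵇ q v))

factors₁₃-no-short-obstruction : all (λ v → allBelow 7 (noShortObstructionᵇ v)) factors₁₃ ≡ true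
factors₁₃-no-short-obstruction = refl

square⇒squareAtStartᵇ : ∀ j q → q < 7 → TBlocks.SquareAt j q → squareAtStartᵇ q (segment t j 13) ≡ true
square⇒squareAtStartᵇ j q q<7 (_ , periodic) = subst₂ (λ x y → x == y ≡ true)
  (sym (take-segment t j q 13 (≤-trans (m≤m+n q q) 2q≤13))) (sym (take-drop-segment t j q q 13 2q≤13))
  (==-complete (segment-shift t j q q periodic))
  where
  2q≤13 : q + q ≤ 13
  2q≤13 = ≤-trans (+-mono-≤ (≤-pred q<7) (≤-pred q<7)) (≤ᵇ⇒≤ 12 13 _)

forbidden⇒forbiddenAtStartᵇ : ∀ j q → q < 7 → ForbiddenAt j q → forbiddenAtStartᵇ q (segment t j 13) ≡ true
forbidden⇒forbiddenAtStartᵇ j (suc q) 1+q<7 (_ , forbidden , periodic) = ∧-intro letters copies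
  where
  2q≤12 : suc q + suc q ≤ 12
  2q≤12 = +-mono-≤ (≤-pred 1+q<7) (≤-pred 1+q<7)
  2q≤13 : suc q + suc q ≤ 13
  2q≤13 = ≤-trans 2q≤12 (≤ᵇ⇒≤ 12 13 _)
  letters : forbiddenᵇ (nth a (segment t j 13) 0) (nth a (segment t j 13) (suc q)) (nth a (segment t j 13) (suc q + suc q)) ≡ true
  letters = subst₂ (λ x y → forbiddenᵇ x y (nth a (segment t j 13) (suc q + suc q)) ≡ true)
      (sym (trans (nth-segment a t j 13 0 (s≤s z≤n)) (cong t (+-identityʳ j))))
      (sym (nth-segment a t j 13 (suc q) (<-≤-trans (m<m+n (suc q) (s≤s z≤n)) 2q≤13)))
    (subst (λ z → forbiddenᵇ (t j) (t (j + suc q)) z ≡ true)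
      (sym (trans (nth-segment a t j 13 (suc q + suc q) (s≤s 2q≤12)) (cong t (sym (+-assoc j (suc q) (suc q))))))
      forbidden)
  copies : take q (drop 1 (segment t j 13)) == take q (drop (suc (suc q)) (segment t j 13)) ≡ true
  copies = subst₂ (λ x y → x == y ≡ true)
    (sym (take-drop-segment t j 1 q 13 (≤-trans (s≤s (m≤m+n q (suc q))) 2q≤13)))
    (sym (take-drop-segment t j (suc (suc q)) q 13 (≤-trans (≤-reflexive (cong suc (sym (+-suc q q)))) 2q≤13)))
    (==-complete (trans (segment-shift t (j + 1) (suc q) q
      (λ x j+1≤x x<j+1+q → periodic x (subst (_≤ x) (+-comm j 1) j+1≤x) (subst (x <_) (+-assoc j 1 q) x<j+1+q)))
      (cong (λ i → segment t i q) (solve 2 (λ x y → x :+ con 1 :+ (con 1 :+ y) := x :+ (con 2 :+ y)) refl j q))))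

no-short-obstruction : ∀ j q → q < 7 → ¬ Obstruction j q
no-short-obstruction j zero    _       obstruction = 1+n≰n ([ proj₁ , proj₁ ]′ obstruction)
no-short-obstruction j (suc q) 1+q<7 obstruction = excluded obstruction
  where
  checked : not (squareAtStartᵇ (suc q) (segment t j 13)) ∧ not (forbiddenAtStartᵇ (suc q) (segment t j 13)) ≡ true
  checked = ∨-resolveˡ (allBelow-sound 7 (noShortObstructionᵇ (segment t j 13))
    (all-∈ᵇ (λ v → allBelow 7 (noShortObstructionᵇ v)) factors₁₃ factors₁₃-no-short-obstruction (segment t j 13) (factor₁₃ j))
    (suc q) 1+q<7) refl
  excluded : ¬ Obstruction j (suc q)
  excluded (inj₁ square)    = true≢false (square⇒squareAtStartᵇ j (suc q) 1+q<7 square) (proj₁ (¬∧¬-elim checked))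
  excluded (inj₂ forbidden) = true≢false (forbidden⇒forbiddenAtStartᵇ j (suc q) 1+q<7 forbidden) (proj₂ (¬∧¬-elim checked))

no-obstruction : ∀ q j → ¬ Obstruction j q
no-obstruction = <-rec (λ q → ∀ j → ¬ Obstruction j q) step
  where
  step : ∀ q → (∀ {q′} → q′ < q → ∀ j → ¬ Obstruction j q′) → ∀ j → ¬ Obstruction j q
  step q shorter-excluded j obstruction = by-length (q <? 7)
    where
    shorter : 7 ≤ q → Obstruction j q → ShorterObstruction q
    shorter long (inj₁ (_ , periodic)) =
      long-square⇒shorter (Φchecks.squareShiftsResolved refl) j q long periodic
    shorter long (inj₂ (_ , forbidden , periodic)) =
      long-forbidden⇒shorter Forbidden (Φchecks.forbiddenShiftsResolved forbiddenᵇ refl) j q long forbidden periodic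
    by-length : Dec (q < 7) → ⊥
    by-length (yes q<7) = no-short-obstruction j q q<7 obstruction
    by-length (no  q≮7) = let j′ , q′ , q′<q , obstruction′ = shorter (≮⇒≥ q≮7) obstruction
                          in shorter-excluded q′<q j′ obstruction′

module WWindows₁₂ = WBlocks.Windows a 6 factors₇ 12 23 ψ-≥23 (≤ᵇ⇒≤ 12 138 _)

w-synchronizing : ∀ y z → (∀ r → r < 12 → w (y + r) ≡ w (z + r)) → WBlocks.IsBlockStart y → WBlocks.IsBlockStart z
w-synchronizing = WWindows₁₂.synchronizing-from factor₇
  (_∈ᵇ (take 12 (ψ a) ∷ take 12 (ψ b) ∷ take 12 (ψ c) ∷ take 12 (ψ d) ∷ [])) refl

module WDesubstitution = WBlocks.Desubstitution 45 ψ-≤45 12 w-synchronizing (Ψchecks.prefixCode refl) (Ψchecks.suffixCode refl)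

-- 57 = 45 + 12, the longest ψ-image plus the synchronization window.
w-no-long-square : ∀ i p → 57 ≤ p → ¬ WBlocks.PeriodicOn p i (i + p)
w-no-long-square i p long periodic =
  let j , q , _ , obstruction = WDesubstitution.Reduction.long-square⇒shorter Forbidden (Ψchecks.squareShiftsResolved refl) i p long periodic
  in no-obstruction q j obstruction

-- Squares, overlaps and 3⁺-repetitions of w

squares : List Word
squares = (O ∷ O ∷ []) ∷ (I ∷ I ∷ []) ∷ (O ∷ O ∷ I ∷ O ∷ O ∷ I ∷ []) ∷ (I ∷ I ∷ O ∷ I ∷ I ∷ O ∷ []) ∷ []

overlaps : List Word
overlaps = (O ∷ O ∷ O ∷ []) ∷ (I ∷ I ∷ I ∷ []) ∷ []

-- The prefix of length m of v has period p (meaningful for m ≤ 4p).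
repetitionᵇ : List Bool → ℕ → ℕ → Bool
repetitionᵇ v p m = take m v == take m (power (take p v) 4)

squareListedᵇ : List Bool → ℕ → Bool
squareListedᵇ v p = (p ≡ᵇ 0) ∨ (not (repetitionᵇ v p (p + p)) ∨ (take (p + p) v ∈ᵇ squares))

-- Periods up to 3 suffice for overlaps and 3⁺-repetitions, by repetition-period≤3.
no3⁺ᵇ : List Bool → ℕ → Bool
no3⁺ᵇ v p = (p ≡ᵇ 0) ∨ not (repetitionᵇ v p (suc (3 * p)))

noLongOverlapᵇ : List Bool → ℕ → Bool
noLongOverlapᵇ v p = (p ≤ᵇ 1) ∨ not (repetitionᵇ v p (suc (2 * p)))

windowOKᵇ : List Bool → Bool
windowOKᵇ v = allBelow 57 (squareListedᵇ v) ∧ (allBelow 4 (no3⁺ᵇ v) ∧ allBelow 4 (noLongOverlapᵇ v))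

module WWindows₁₁₂ = WBlocks.Windows a 6 factors₇ 112 23 ψ-≥23 (≤ᵇ⇒≤ 112 138 _)

windows-OK : WWindows₁₁₂.windowsᵇ (λ _ v → windowOKᵇ v) ≡ true
windows-OK = refl

window-OK : ∀ y → windowOKᵇ (segment w y 112) ≡ true
window-OK y = let _ , _ , _ , _ , ok = WWindows₁₁₂.every-window factor₇ (λ _ v → windowOKᵇ v) windows-OK y in ok

window-squares : ∀ i → allBelow 57 (squareListedᵇ (segment w i 112)) ≡ true
window-squares i = ∧-elimˡ (window-OK i)

window-no3⁺ : ∀ i → allBelow 4 (no3⁺ᵇ (segment w i 112)) ≡ true
window-no3⁺ i = ∧-elimˡ (∧-elimʳ {allBelow 57 (squareListedᵇ (segment w i 112))} (window-OK i))

window-noLongOverlap : ∀ i → allBelow 4 (noLongOverlapᵇ (segment w i 112)) ≡ true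
window-noLongOverlap i = ∧-elimʳ {allBelow 4 (no3⁺ᵇ (segment w i 112))}
  (∧-elimʳ {allBelow 57 (squareListedᵇ (segment w i 112))} (window-OK i))

window-repetition : ∀ i (x u : Word) → slice w i (length x) ≡ x → IsRepetitionWith x u →
  ∀ m → m ≤ length x → m ≤ 112 → m ≤ 4 * length u → length u ≤ m → repetitionᵇ (segment w i 112) (length u) m ≡ true
window-repetition i x u occ rep m m≤x m≤112 m≤4p p≤m = subst₂ (λ y z → y == z ≡ true) (sym prefix≡) (sym period≡)
  (==-refl (take m (power u 4)))
  where
  m≤u⁴ : m ≤ length (power u 4)
  m≤u⁴ = subst (m ≤_) (sym (length-power-4 u)) m≤4p
  prefix≡ : take m (segment w i 112) ≡ take m (power u 4)
  prefix≡ = trans (take-segment w i m 112 m≤112) (trans (occurrence-prefix w i x m occ m≤x) (repetition-prefix rep m m≤x m≤u⁴))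
  u≡ : take (length u) (segment w i 112) ≡ u
  u≡ = begin
    take p W                     ≡⟨ cong (λ n → take n W) (sym (m≤n⇒m⊓n≡m p≤m)) ⟩
    take (p ⊓ m) W               ≡⟨ sym (take-take p m W) ⟩
    take p (take m W)            ≡⟨ cong (take p) prefix≡ ⟩
    take p (take m (power u 4))  ≡⟨ take-take p m (power u 4) ⟩
    take (p ⊓ m) (power u 4)     ≡⟨ cong (λ n → take n (power u 4)) (m≤n⇒m⊓n≡m p≤m) ⟩
    take p (power u 4)           ≡⟨ take-++-length u (power u 3) ⟩
    u                            ∎
    where
    open ≡-Reasoning
    p = length u
    W = segment w i 112
  period≡ : take m (power (take (length u) (segment w i 112)) 4) ≡ take m (power u 4)
  period≡ = cong (λ z → take m (power z 4)) u≡

squares-length : ∀ {z} → z ∈ squares → length z ≡ 2 ⊎ length z ≡ 6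
squares-length (here refl)                         = inj₁ refl
squares-length (there (here refl))                 = inj₁ refl
squares-length (there (there (here refl)))         = inj₂ refl
squares-length (there (there (there (here refl)))) = inj₂ refl

double-injective : ∀ {m n} → m + m ≡ n + n → m ≡ n
double-injective {m} {n} e with <-cmp m n
... | tri< m<n _ _ = ⊥-elim (<-irrefl e (+-mono-< m<n m<n))
... | tri≈ _ m≡n _ = m≡n
... | tri> _ _ n<m = ⊥-elim (<-irrefl (sym e) (+-mono-< n<m n<m))

square-period : ∀ {u : Word} → u ++ u ∈ squares → length u ≡ 1 ⊎ length u ≡ 3
square-period {u} listed with squares-length listed
... | inj₁ len≡2 = inj₁ (double-injective (trans (sym (length-++ u)) len≡2))
... | inj₂ len≡6 = inj₂ (double-injective (trans (sym (length-++ u)) len≡6))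

nonempty⇒pos : ∀ {u : Word} → ¬ u ≡ [] → 1 ≤ length u
nonempty⇒pos {[]}    u≢[] = ⊥-elim (u≢[] refl)
nonempty⇒pos {_ ∷ _} _    = s≤s z≤n

pos⇒≡ᵇ0-false : ∀ {p} → 1 ≤ p → (p ≡ᵇ 0) ≡ false
pos⇒≡ᵇ0-false (s≤s _) = refl

square-repetition : ∀ {u : Word} → ¬ u ≡ [] → IsRepetitionWith (u ++ u) u
square-repetition {u} u≢[] = u≢[] , 2 , [] , [] , sym (trans (++-identityʳ (u ++ (u ++ []))) (cong (u ++_) (++-identityʳ u)))

square-period≤3 : ∀ {u : Word} → u ++ u ∈ squares → length u ≤ 3
square-period≤3 {u} listed = [ (λ p≡1 → ≤-trans (≤-reflexive p≡1) (≤ᵇ⇒≤ 1 3 _)) , ≤-reflexive ]′ (square-period {u} listed)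

w-square-listed : ∀ {u : Word} → ¬ u ≡ [] → IsFactor (u ++ u) w → u ++ u ∈ squares
w-square-listed {u} u≢[] (i , occ) = by-period (length u <? 57)
  where
  p = length u
  W = segment w i 112
  seg : segment w i (p + p) ≡ u ++ u
  seg = trans (cong (segment w i) (sym (length-++ u))) (trans (sym (slice≡segment w i _)) occ)
  by-period : Dec (p < 57) → u ++ u ∈ squares
  by-period (no  p≮57) = ⊥-elim (w-no-long-square i p (≮⇒≥ p≮57) (square-occurrence⇒periodic w i u seg))
  by-period (yes p<57) = ∈ᵇ-sound (u ++ u) squares (subst (λ z → z ∈ᵇ squares ≡ true) prefix≡ listed)
    where
    p+p≤112 : p + p ≤ 112
    p+p≤112 = ≤-trans (+-mono-≤ (≤-pred p<57) (≤-pred p<57)) (≤ᵇ⇒≤ 112 112 _)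
    prefix≡ : take (p + p) W ≡ u ++ u
    prefix≡ = trans (take-segment w i (p + p) 112 p+p≤112) seg
    repetition : repetitionᵇ W p (p + p) ≡ true
    repetition = window-repetition i (u ++ u) u occ (square-repetition u≢[]) (p + p)
      (≤-reflexive (sym (length-++ u))) p+p≤112 (+-monoʳ-≤ p (m≤m+n p _)) (m≤m+n p p)
    listed : take (p + p) W ∈ᵇ squares ≡ true
    listed = ∨-resolveˡ (∨-resolveˡ (allBelow-sound 57 (squareListedᵇ W) (window-squares i) p p<57)
      (pos⇒≡ᵇ0-false (nonempty⇒pos u≢[]))) (cong not repetition)

repetition-period≤3 : ∀ {x u} → IsFactor x w → IsRepetitionWith x u → 2 * length u ≤ length x → length u ≤ 3
repetition-period≤3 {x} {u} (i , occ) rep 2p≤x = square-period≤3 {u} (w-square-listed (proj₁ rep) (i , square-occ))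
  where
  p = length u
  p+p≤x : p + p ≤ length x
  p+p≤x = subst (_≤ length x) (cong (p +_) (+-identityʳ p)) 2p≤x
  square-occ : slice w i (length (u ++ u)) ≡ u ++ u
  square-occ = begin
    slice w i (length (u ++ u))  ≡⟨ trans (slice≡segment w i _) (cong (segment w i) (length-++ u)) ⟩
    segment w i (p + p)          ≡⟨ occurrence-prefix w i x (p + p) occ p+p≤x ⟩
    take (p + p) x               ≡⟨ repetition-prefix rep (p + p) p+p≤x (subst (p + p ≤_) (sym (length-power-4 u)) (+-monoʳ-≤ p (m≤m+n p _))) ⟩
    take (p + p) (power u 4)     ≡⟨ take-power-2 u 2 ⟩
    u ++ u                       ∎
    where open ≡-Reasoning

short-window-repetition : ∀ i (x u : Word) k → slice w i (length x) ≡ x → IsRepetitionWith x u → length u ≤ 3 →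
  1 ≤ k → k ≤ 3 → k * length u < length x → repetitionᵇ (segment w i 112) (length u) (suc (k * length u)) ≡ true
short-window-repetition i x u k occ rep p≤3 k-pos k≤3 kp<x = window-repetition i x u occ rep (suc (k * p)) kp<x
  (≤-trans (s≤s (*-mono-≤ k≤3 p≤3)) (≤ᵇ⇒≤ 10 112 _))
  (≤-trans (+-monoˡ-≤ (k * p) (nonempty⇒pos (proj₁ rep))) (+-monoʳ-≤ p (*-monoˡ-≤ p k≤3)))
  (≤-trans (m≤n*m p k {{>-nonZero k-pos}}) (n≤1+n (k * p)))
  where
  p = length u

not-true : ∀ {x} → not x ≡ true → x ≡ false
not-true {false} _ = refl

w-3⁺-free : ThreePlusFree w
w-3⁺-free x (i , occ) (u , rep , 3p<x) = true≢false (short-window-repetition i x u 3 occ rep p≤3 (s≤s z≤n) ≤-refl 3p<x)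
  (not-true (∨-resolveˡ (allBelow-sound 4 (no3⁺ᵇ (segment w i 112)) (window-no3⁺ i) p (s≤s p≤3))
    (pos⇒≡ᵇ0-false (nonempty⇒pos (proj₁ rep)))))
  where
  p = length u
  p≤3 : p ≤ 3
  p≤3 = repetition-period≤3 (i , occ) rep (≤-trans (*-monoˡ-≤ p (≤ᵇ⇒≤ 2 3 _)) (<⇒≤ 3p<x))

w-overlap-listed : ∀ z → IsFactor z w × IsOverlap z → z ∈ overlaps
w-overlap-listed z ((i , occ) , u , rep , 2p<z) = by-period u rep 2p<z
  where
  by-period : ∀ u → IsRepetitionWith z u → 2 * length u < length z → z ∈ overlaps
  by-period []            rep _    = ⊥-elim (proj₁ rep refl)
  by-period (β ∷ [])      rep 2<z  = listed β (trans (sym (take-all 3 z (≤-reflexive |z|≡3)))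
                                       (repetition-prefix rep 3 (≤-reflexive (sym |z|≡3)) (≤ᵇ⇒≤ 3 4 _)))
    where
    |z|≡3 : length z ≡ 3
    |z|≡3 = ≤-antisym (≮⇒≥ (λ 3<z → w-3⁺-free z (i , occ) ((β ∷ []) , rep , 3<z))) 2<z
    listed : ∀ β → z ≡ take 3 (power (β ∷ []) 4) → z ∈ overlaps
    listed O refl = here refl
    listed I refl = there (here refl)
  by-period u@(_ ∷ _ ∷ _) rep 2p<z = ⊥-elim (true≢false
    (short-window-repetition i z u 2 occ rep p≤3 (s≤s z≤n) (≤ᵇ⇒≤ 2 3 _) 2p<z)
    (not-true (∨-resolveˡ (allBelow-sound 4 (noLongOverlapᵇ (segment w i 112)) (window-noLongOverlap i) p (s≤s p≤3)) refl)))
    where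
    p = length u
    p≤3 : p ≤ 3
    p≤3 = repetition-period≤3 (i , occ) rep (<⇒≤ 2p<z)

occurs : ∀ i (x : Word) → take (length x) (drop i (Ψt.imageChain 2)) ≡ x → i + length x ≤ length (Ψt.imageChain 2) → IsFactor x w
occurs i x prefix≡ fits = i , trans (slice≡segment w i (length x))
  (trans (segment≡take-drop false w i (length x) (Ψt.imageChain 2) i
    (λ k k<n → Ψt.Image.limit-nth 2 (i + k) (<-≤-trans (+-monoʳ-< i k<n) fits)) fits) prefix≡)

w-overlaps : ExactlyNFactors w IsOverlap 2
w-overlaps = overlaps , refl , ((λ ()) ∷ []) ∷ [] ∷ [] ,
  (occurs 14 _ refl (≤ᵇ⇒≤ 17 _ _) , (O ∷ []) , ((λ ()) , 3 , [] , [] , refl) , ≤-refl) ∷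
  (occurs 3 _ refl (≤ᵇ⇒≤ 6 _ _) , (I ∷ []) , ((λ ()) , 3 , [] , [] , refl) , ≤-refl) ∷ [] ,
  w-overlap-listed

w-squares : ExactlyNFactors w IsSquare 4
w-squares = squares , refl ,
  ((λ ()) ∷ (λ ()) ∷ (λ ()) ∷ []) ∷ ((λ ()) ∷ (λ ()) ∷ []) ∷ ((λ ()) ∷ []) ∷ [] ∷ [] ,
  (occurs 1 _ refl (≤ᵇ⇒≤ 3 _ _) , (O ∷ []) , (λ ()) , refl) ∷
  (occurs 3 _ refl (≤ᵇ⇒≤ 5 _ _) , (I ∷ []) , (λ ()) , refl) ∷
  (occurs 15 _ refl (≤ᵇ⇒≤ 21 _ _) , (O ∷ O ∷ I ∷ []) , (λ ()) , refl) ∷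
  (occurs 4 _ refl (≤ᵇ⇒≤ 10 _ _) , (I ∷ I ∷ O ∷ []) , (λ ()) , refl) ∷ [] ,
  λ { z (occ , u , u≢[] , refl) → w-square-listed u≢[] occ }

w-no-even-period-square : ∀ x → IsFactor x w → ¬ IsEvenPeriodSquare x
w-no-even-period-square x occ (u , (u≢[] , refl) , even) =
  [ (λ p≡1 → odd-1 (subst Even p≡1 even)) , (λ p≡3 → odd-3 (subst Even p≡3 even)) ]′ (square-period {u} (w-square-listed u≢[] occ))
  where
  odd-1 : ¬ Even 1
  odd-1 ()
  odd-3 : ¬ Even 3
  odd-3 (even-ss ())

corollary3 : ∃[ w ] (ThreePlusFree w
    × ExactlyNFactors w IsOverlap 2
    × ExactlyNFactors w IsSquare 4
    × (∀ x → IsFactor x w → ¬ IsEvenPeriodSquare x))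
corollary3 = w , w-3⁺-free , w-overlaps , w-squares , w-no-even-period-square
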